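{- For positive integers $k_1,k_2$, $p\in\mathbb{N}_0$ and all $n\in\mathbb{N}$, \begin{align*} H_n(-p,k_1,k_2)=&H_n(-p)H_n(k_1,k_2)-\frac{1}{p+1}\sum_{j=p+2-k_1}^p\binom{p+1}{j}B_jH_n(k_1+j-p-1,k_2)\\ &+\frac{1}{p+1}\sum_{j_1=0}^{p+1-k_1}\sum_{j_2=p+3-k_1-k_2-j_1}^{p+1-k_1-j_1}\frac{\binom{p+1}{j_1}\binom{p+2-k_1-j_1}{j_2}}{p+2-k_1-j_1}B_{j_1}B_{j_2}H_n(k_1+k_2+j_1+j_2-p-2)\\ &+\frac{1}{p+1}\sum_{j_1=0}^{p+1-k_1}\sum_{j_2=0}^{p+2-k_1-k_2-j_1}\sum_{j_3=0}^{p+2-k_1-k_2-j_1-j_2}\frac{\binom{p+1}{j_1}\binom{p+2-k_1-j_1}{j_2}\binom{p+3-k_1-k_2-j_1-j_2}{j_3}}{(p+2-k_1-j_1)(p+3-k_1-k_2-j_1-j_2)}B_{j_1}B_{j_2}B_{j_3}\,n^{p+3-k_1-k_2-j_1-j_2-j_3}\\ &-\frac{1}{p+1}\sum_{j=0}^{p+1-k_1}\sum_{l=0}^{p+1-k_1-j}\frac{\binom{p+1}{j}\binom{p+2-k_1-j}{l}}{p+2-k_1-j}\,n^{p+2-k_1-j-l}B_jB_lH_n(k_2). \end{align*}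
   Context: For $n\in\mathbb{N}$ and $(k_1,\dots,k_r)\in\mathbb{Z}^r$, $H_n(k_1,\dots,k_r)=\sum_{n\ge n_1>\dots>n_r>0}n_1^{ -k_1}\cdots n_r^{ -k_r}$ (with $H_n(k_1,\dots,k_r)=0$ if $n<r$); thus $H_n(-p)=\sum_{m=1}^nm^p$ and $H_n(-p,k_1,k_2)=\sum_{m=1}^nm^pH_{m-1}(k_1,k_2)$. Bernoulli numbers: $\frac{te^t}{e^t-1}=\sum_{j\ge0}B_j\frac{t^j}{j!}$ (so $B_1=1/2$). Sums with empty range are $0$. -}

module Defs where

open import Data.Nat as ℕ using (ℕ; zero; suc)
open import Data.Nat.Combinatorics using (_C_)
open import Data.Integer as ℤ using (ℤ; +_; -[1+_])
open import Data.Rational as ℚ using (ℚ; 0ℚ; 1ℚ; _/_)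
open import Data.List using (List; []; _∷_; _++_; [_]; length; zipWith; upTo; foldr)

ℕtoℚ : ℕ → ℚ
ℕtoℚ m = + m / 1

-- reciprocal of a natural number, with the (never used) convention 1/0 = 0
invℕ : ℕ → ℚ
invℕ zero = 0ℚ
invℕ (suc m) = + 1 / suc m

-- reciprocal of an integer, with the (never used) convention 1/0 = 0
invℤ : ℤ → ℚ
invℤ (+ m) = invℕ m
invℤ -[1+ m ] = ℚ.- invℕ (suc m)

powℚ : ℚ → ℕ → ℚ
powℚ q zero = 1ℚ
powℚ q (suc e) = q ℚ.* powℚ q e

-- m ^ e for an integer exponent e (m ≥ 1 in all uses)
powℤ : ℕ → ℤ → ℚ
powℤ m (+ e) = powℚ (ℕtoℚ m) e
powℤ m -[1+ e ] = powℚ (invℕ m) (suc e)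

binom : ℤ → ℤ → ℚ
binom (+ a) (+ b) = ℕtoℚ (a C b)
binom _ _ = 0ℚ

sumℚ : List ℚ → ℚ
sumℚ = foldr ℚ._+_ 0ℚ

-- Σ_{i=a}^{b} f i over integers; empty (= 0) when b < a
sumFrom : ℤ → ℕ → (ℤ → ℚ) → ℚ
sumFrom a zero f = 0ℚ
sumFrom a (suc c) f = f a ℚ.+ sumFrom (a ℤ.+ + 1) c f

clamp : ℤ → ℕ
clamp (+ m) = m
clamp -[1+ _ ] = 0

Σ[_⋯_] : ℤ → ℤ → (ℤ → ℚ) → ℚ
Σ[ a ⋯ b ] f = sumFrom a (clamp (b ℤ.- a ℤ.+ + 1)) f

-- Bernoulli numbers with B₁ = +1/2, i.e. t e^t/(e^t - 1) = Σ B_j t^j / j!.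
-- Equivalent to the recurrence Σ_{i=0}^{j} C(j+1,i) B_i = j+1  (j ≥ 0).
-- nextB j bs: given bs = [B_0,…,B_{j-1}], computes B_j.
nextB : ℕ → List ℚ → ℚ
nextB j bs =
  (ℕtoℚ (suc j) ℚ.- sumℚ (zipWith (λ i b → ℕtoℚ (suc j C i) ℚ.* b) (upTo j) bs))
    ℚ.* invℕ (suc j)

bernList : ℕ → List ℚ
bernList zero = []
bernList (suc n) = bernList n ++ [ nextB n (bernList n) ]

bernoulliℕ : ℕ → ℚ
bernoulliℕ j = nextB j (bernList j)

-- B_j for integer index (0 for negative j; only ever multiplied by a vanishing binomial)
B : ℤ → ℚ
B (+ j) = bernoulliℕ j
B -[1+ _ ] = 0ℚ

-- H_n(k_1,…,k_r) = Σ_{n ≥ n_1 > … > n_r > 0} n_1^{-k_1} ⋯ n_r^{-k_r}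
H : ℕ → List ℤ → ℚ
H n [] = 1ℚ
H zero (k ∷ ks) = 0ℚ
H (suc m) (k ∷ ks) = H m (k ∷ ks) ℚ.+ powℤ (suc m) (ℤ.- k) ℚ.* H m ks

{-# OPTIONS --safe #-}
module Submission where

-- Faulhaber's formula H_n(-p) = (1/(p+1)) Σ_{j=0}^{p} C(p+1,j) B_j n^{p+1-j} follows by telescoping
-- in n from the recurrence Σ_{i<m} C(m,i) B_i = m. Summing by parts against it gives
--   H_n(-p,k,ks) = H_n(-p) H_n(k,ks) - 1/(p+1) Σ_{j=0}^{p} C(p+1,j) B_j H_n(k+j-p-1, ks).
-- Applied to (-p,k₁,k₂), the terms with j ≥ p+2-k₁ form the second sum of the corollary. For
-- j ≤ p+1-k₁ the first index is -d ≤ 0, so H_n(-d,k₂) is expanded by the same identity, and every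
-- H_n(-r) with r ≥ 0 that appears is replaced by Faulhaber's formula: this yields the other three sums.

open import Defs
open import Data.Nat as ℕ using (ℕ; zero; suc; _≤_; _<_; z≤n; s≤s; _!)
import Data.Nat.Properties as ℕP
import Data.Nat.DivMod as ℕD
import Data.Nat.Tactic.RingSolver as ℕ-Ring
open import Data.Nat.Combinatorics
  using (_C_; nCk≡n!/k![n-k]!; k![n∸k]!∣n!; nCk+nC[k+1]≡[n+1]C[k+1]; k>n⇒nCk≡0; nCn≡1; nC1≡n; nCk≡nC[n∸k])
import Data.Nat.Coprimality as Coprime
open import Data.Integer as ℤ using (ℤ; +_; -[1+_])
import Data.Integer.Properties as ℤP
open import Data.Integer.Tactic.RingSolver using (solve-∀)
open import Data.Rational as ℚ using (ℚ; mkℚ; 0ℚ; 1ℚ)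
import Data.Rational.Properties as ℚP
import Data.Rational.Unnormalised as ℚᵘ
import Data.Rational.Unnormalised.Properties as ℚᵘP
open import Data.Rational.Solver using (module +-*-Solver)
open import Data.List using (List; []; _∷_; _++_; [_]; map; zipWith; upTo; applyUpTo)
import Data.List.Properties as ListP
open import Data.Product using (Σ; _,_)
open import Relation.Binary.PropositionalEquality hiding ([_])
open ≡-Reasoning

ℕtoℚ-normalised : ℕ → ℚ
ℕtoℚ-normalised m = mkℚ (+ m) 0 (Coprime.sym (Coprime.1-coprimeTo m))

ℕtoℚ≡mkℚ : ∀ m → ℕtoℚ m ≡ ℕtoℚ-normalised m
ℕtoℚ≡mkℚ m = ℚP.normalize-coprime (Coprime.sym (Coprime.1-coprimeTo m))

ℕtoℚ-homo-+ : ∀ a b → ℕtoℚ (a ℕ.+ b) ≡ ℕtoℚ a ℚ.+ ℕtoℚ b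
ℕtoℚ-homo-+ a b rewrite ℕtoℚ≡mkℚ (a ℕ.+ b) | ℕtoℚ≡mkℚ a | ℕtoℚ≡mkℚ b =
  ℚP.toℚᵘ-injective (ℚᵘP.≃-trans (ℚᵘ.*≡* (cross-multiplied (+ a) (+ b)))
                                 (ℚᵘP.≃-sym (ℚP.toℚᵘ-homo-+ (ℕtoℚ-normalised a) (ℕtoℚ-normalised b))))
  where
  cross-multiplied : ∀ x y → (x ℤ.+ y) ℤ.* + 1 ≡ (x ℤ.* + 1 ℤ.+ y ℤ.* + 1) ℤ.* + 1
  cross-multiplied = solve-∀

ℕtoℚ-homo-* : ∀ a b → ℕtoℚ (a ℕ.* b) ≡ ℕtoℚ a ℚ.* ℕtoℚ b
ℕtoℚ-homo-* a b rewrite ℕtoℚ≡mkℚ (a ℕ.* b) | ℕtoℚ≡mkℚ a | ℕtoℚ≡mkℚ b =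
  ℚP.toℚᵘ-injective (ℚᵘP.≃-trans (ℚᵘ.*≡* (cong (ℤ._* + 1) (ℤP.pos-* a b)))
                                 (ℚᵘP.≃-sym (ℚP.toℚᵘ-homo-* (ℕtoℚ-normalised a) (ℕtoℚ-normalised b))))

ℕtoℚ-suc : ∀ m → ℕtoℚ (suc m) ≡ 1ℚ ℚ.+ ℕtoℚ m
ℕtoℚ-suc = ℕtoℚ-homo-+ 1

invℕ-inverseˡ : ∀ m → invℕ (suc m) ℚ.* ℕtoℚ (suc m) ≡ 1ℚ
invℕ-inverseˡ m rewrite ℚP.normalize-coprime (Coprime.1-coprimeTo (suc m)) | ℕtoℚ≡mkℚ (suc m) =
  ℚP.*-inverseˡ (ℕtoℚ-normalised (suc m))

invℕ-homo-* : ∀ a b → invℕ (suc a ℕ.* suc b) ≡ invℕ (suc a) ℚ.* invℕ (suc b)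
invℕ-homo-* a b = inverse-unique (invℕ-inverseˡ (b ℕ.+ a ℕ.* suc b)) (begin
  invℕ (suc a) ℚ.* invℕ (suc b) ℚ.* ℕtoℚ (suc a ℕ.* suc b)
    ≡⟨ cong (invℕ (suc a) ℚ.* invℕ (suc b) ℚ.*_) (ℕtoℚ-homo-* (suc a) (suc b)) ⟩
  invℕ (suc a) ℚ.* invℕ (suc b) ℚ.* (ℕtoℚ (suc a) ℚ.* ℕtoℚ (suc b))
    ≡⟨ solve 4 (λ x y z w → x :* y :* (z :* w) := (x :* z) :* (y :* w)) refl
         (invℕ (suc a)) (invℕ (suc b)) (ℕtoℚ (suc a)) (ℕtoℚ (suc b)) ⟩
  (invℕ (suc a) ℚ.* ℕtoℚ (suc a)) ℚ.* (invℕ (suc b) ℚ.* ℕtoℚ (suc b))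
    ≡⟨ cong₂ ℚ._*_ (invℕ-inverseˡ a) (invℕ-inverseˡ b) ⟩
  1ℚ ∎)
  where
  open +-*-Solver
  inverse-unique : ∀ {x y w} → x ℚ.* w ≡ 1ℚ → y ℚ.* w ≡ 1ℚ → x ≡ y
  inverse-unique {x} {y} {w} xw≡1 yw≡1 = begin
    x                ≡⟨ solve 1 (λ x → x := x :* con 1ℚ) refl x ⟩
    x ℚ.* 1ℚ         ≡⟨ cong (x ℚ.*_) (sym yw≡1) ⟩
    x ℚ.* (y ℚ.* w)  ≡⟨ solve 3 (λ x y w → x :* (y :* w) := y :* (x :* w)) refl x y w ⟩
    y ℚ.* (x ℚ.* w)  ≡⟨ cong (y ℚ.*_) xw≡1 ⟩
    y ℚ.* 1ℚ         ≡⟨ ℚP.*-identityʳ y ⟩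
    y                ∎

powℚ-distribˡ-+-* : ∀ q a b → powℚ q (a ℕ.+ b) ≡ powℚ q a ℚ.* powℚ q b
powℚ-distribˡ-+-* q zero b = sym (ℚP.*-identityˡ (powℚ q b))
powℚ-distribˡ-+-* q (suc a) b = begin
  q ℚ.* powℚ q (a ℕ.+ b)         ≡⟨ cong (q ℚ.*_) (powℚ-distribˡ-+-* q a b) ⟩
  q ℚ.* (powℚ q a ℚ.* powℚ q b)  ≡⟨ ℚP.*-assoc q (powℚ q a) (powℚ q b) ⟨
  q ℚ.* powℚ q a ℚ.* powℚ q b    ∎

powℚ-distribʳ-* : ∀ x y e → powℚ (x ℚ.* y) e ≡ powℚ x e ℚ.* powℚ y e
powℚ-distribʳ-* x y zero = refl
powℚ-distribʳ-* x y (suc e) = begin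
  x ℚ.* y ℚ.* powℚ (x ℚ.* y) e          ≡⟨ cong (x ℚ.* y ℚ.*_) (powℚ-distribʳ-* x y e) ⟩
  x ℚ.* y ℚ.* (powℚ x e ℚ.* powℚ y e)
    ≡⟨ solve 4 (λ x y a b → x :* y :* (a :* b) := x :* a :* (y :* b)) refl x y (powℚ x e) (powℚ y e) ⟩
  x ℚ.* powℚ x e ℚ.* (y ℚ.* powℚ y e)   ∎
  where open +-*-Solver

powℚ-zeroˡ : ∀ e → powℚ 1ℚ e ≡ 1ℚ
powℚ-zeroˡ zero = refl
powℚ-zeroˡ (suc e) = trans (cong (1ℚ ℚ.*_) (powℚ-zeroˡ e)) (ℚP.*-identityʳ 1ℚ)

ℤ-as-difference : (z : ℤ) → Σ ℕ λ a → Σ ℕ λ b → z ≡ + a ℤ.- + b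
ℤ-as-difference (+ a) = a , 0 , sym (ℤP.+-identityʳ (+ a))
ℤ-as-difference -[1+ b ] = 0 , suc b , refl

module _ (m : ℕ) where
  private
    u v : ℚ
    u = ℕtoℚ (suc m)
    v = invℕ (suc m)

  invℕ^e*ℕ^e≡1 : ∀ e → powℚ v e ℚ.* powℚ u e ≡ 1ℚ
  invℕ^e*ℕ^e≡1 e = begin
    powℚ v e ℚ.* powℚ u e  ≡⟨ powℚ-distribʳ-* v u e ⟨
    powℚ (v ℚ.* u) e       ≡⟨ cong (λ z → powℚ z e) (invℕ-inverseˡ m) ⟩
    powℚ 1ℚ e              ≡⟨ powℚ-zeroˡ e ⟩
    1ℚ                     ∎

  powℤ[a-b]*m^b≡m^a : ∀ a b → powℤ (suc m) (+ a ℤ.- + b) ℚ.* powℚ u b ≡ powℚ u a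
  powℤ[a-b]*m^b≡m^a a zero = trans (cong (λ z → powℤ (suc m) z ℚ.* 1ℚ) (ℤP.+-identityʳ (+ a))) (ℚP.*-identityʳ (powℚ u a))
  powℤ[a-b]*m^b≡m^a zero (suc b) = invℕ^e*ℕ^e≡1 (suc b)
  powℤ[a-b]*m^b≡m^a (suc a) (suc b) = begin
    powℤ (suc m) (+ suc a ℤ.- + suc b) ℚ.* (u ℚ.* powℚ u b)
      ≡⟨ cong (λ z → powℤ (suc m) z ℚ.* (u ℚ.* powℚ u b)) (trans (ℤP.[1+m]⊖[1+n]≡m⊖n a b) (sym (ℤP.m-n≡m⊖n a b))) ⟩
    powℤ (suc m) (+ a ℤ.- + b) ℚ.* (u ℚ.* powℚ u b)
      ≡⟨ solve 3 (λ x u w → x :* (u :* w) := u :* (x :* w)) refl (powℤ (suc m) (+ a ℤ.- + b)) u (powℚ u b) ⟩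
    u ℚ.* (powℤ (suc m) (+ a ℤ.- + b) ℚ.* powℚ u b)
      ≡⟨ cong (u ℚ.*_) (powℤ[a-b]*m^b≡m^a a b) ⟩
    u ℚ.* powℚ u a ∎
    where open +-*-Solver

  -- With x = a - b and y = c - d, multiplying by m^(b+d) leaves only natural exponents.
  powℤ-homo-+ : ∀ x y → powℤ (suc m) x ℚ.* powℤ (suc m) y ≡ powℤ (suc m) (x ℤ.+ y)
  powℤ-homo-+ x y with ℤ-as-difference x | ℤ-as-difference y
  ... | a , b , x≡a-b | c , d , y≡c-d = begin
    X ℚ.* Y
      ≡⟨ ℚP.*-identityʳ (X ℚ.* Y) ⟨
    X ℚ.* Y ℚ.* 1ℚ
      ≡⟨ cong (X ℚ.* Y ℚ.*_) (sym (invℕ^e*ℕ^e≡1 (b ℕ.+ d))) ⟩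
    X ℚ.* Y ℚ.* (powℚ v (b ℕ.+ d) ℚ.* powℚ u (b ℕ.+ d))
      ≡⟨ cong (λ z → X ℚ.* Y ℚ.* (powℚ v (b ℕ.+ d) ℚ.* z)) (powℚ-distribˡ-+-* u b d) ⟩
    X ℚ.* Y ℚ.* (powℚ v (b ℕ.+ d) ℚ.* (powℚ u b ℚ.* powℚ u d))
      ≡⟨ solve 5 (λ X Y V B D → X :* Y :* (V :* (B :* D)) := (X :* B) :* (Y :* D) :* V) refl
           X Y (powℚ v (b ℕ.+ d)) (powℚ u b) (powℚ u d) ⟩
    (X ℚ.* powℚ u b) ℚ.* (Y ℚ.* powℚ u d) ℚ.* powℚ v (b ℕ.+ d)
      ≡⟨ cong₂ (λ s t → s ℚ.* t ℚ.* powℚ v (b ℕ.+ d))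
           (trans (cong (λ z → powℤ (suc m) z ℚ.* powℚ u b) x≡a-b) (powℤ[a-b]*m^b≡m^a a b))
           (trans (cong (λ z → powℤ (suc m) z ℚ.* powℚ u d) y≡c-d) (powℤ[a-b]*m^b≡m^a c d)) ⟩
    powℚ u a ℚ.* powℚ u c ℚ.* powℚ v (b ℕ.+ d)
      ≡⟨ cong (ℚ._* powℚ v (b ℕ.+ d)) (sym (powℚ-distribˡ-+-* u a c)) ⟩
    powℚ u (a ℕ.+ c) ℚ.* powℚ v (b ℕ.+ d)
      ≡⟨ cong (ℚ._* powℚ v (b ℕ.+ d)) (sym (powℤ[a-b]*m^b≡m^a (a ℕ.+ c) (b ℕ.+ d))) ⟩
    Z ℚ.* powℚ u (b ℕ.+ d) ℚ.* powℚ v (b ℕ.+ d)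
      ≡⟨ solve 3 (λ Z U V → Z :* U :* V := Z :* (V :* U)) refl Z (powℚ u (b ℕ.+ d)) (powℚ v (b ℕ.+ d)) ⟩
    Z ℚ.* (powℚ v (b ℕ.+ d) ℚ.* powℚ u (b ℕ.+ d))
      ≡⟨ cong (Z ℚ.*_) (invℕ^e*ℕ^e≡1 (b ℕ.+ d)) ⟩
    Z ℚ.* 1ℚ
      ≡⟨ ℚP.*-identityʳ Z ⟩
    Z
      ≡⟨ cong (powℤ (suc m)) (sym x+y≡[a+c]-[b+d]) ⟩
    powℤ (suc m) (x ℤ.+ y) ∎
    where
    open +-*-Solver
    X Y Z : ℚ
    X = powℤ (suc m) x
    Y = powℤ (suc m) y
    Z = powℤ (suc m) (+ (a ℕ.+ c) ℤ.- + (b ℕ.+ d))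
    regroup : ∀ a b c d → (a ℤ.- b) ℤ.+ (c ℤ.- d) ≡ (a ℤ.+ c) ℤ.- (b ℤ.+ d)
    regroup = solve-∀
    x+y≡[a+c]-[b+d] : x ℤ.+ y ≡ + (a ℕ.+ c) ℤ.- + (b ℕ.+ d)
    x+y≡[a+c]-[b+d] = trans (cong₂ ℤ._+_ x≡a-b y≡c-d) (regroup (+ a) (+ b) (+ c) (+ d))

ΣN : ℕ → (ℕ → ℚ) → ℚ
ΣN zero f = 0ℚ
ΣN (suc c) f = f 0 ℚ.+ ΣN c (λ i → f (suc i))

ΣN-cong : ∀ c {f g : ℕ → ℚ} → (∀ i → i < c → f i ≡ g i) → ΣN c f ≡ ΣN c g
ΣN-cong zero f≗g = refl
ΣN-cong (suc c) f≗g = cong₂ ℚ._+_ (f≗g 0 (s≤s z≤n)) (ΣN-cong c (λ i i<c → f≗g (suc i) (s≤s i<c)))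

ΣN-0ℚ : ∀ c → ΣN c (λ _ → 0ℚ) ≡ 0ℚ
ΣN-0ℚ zero = refl
ΣN-0ℚ (suc c) = trans (ℚP.+-identityˡ (ΣN c (λ _ → 0ℚ))) (ΣN-0ℚ c)

ΣN-distrib-+ : ∀ c (f g : ℕ → ℚ) → ΣN c (λ i → f i ℚ.+ g i) ≡ ΣN c f ℚ.+ ΣN c g
ΣN-distrib-+ zero f g = refl
ΣN-distrib-+ (suc c) f g = begin
  f 0 ℚ.+ g 0 ℚ.+ ΣN c (λ i → f (suc i) ℚ.+ g (suc i))
    ≡⟨ cong (f 0 ℚ.+ g 0 ℚ.+_) (ΣN-distrib-+ c (λ i → f (suc i)) (λ i → g (suc i))) ⟩
  f 0 ℚ.+ g 0 ℚ.+ (ΣN c (λ i → f (suc i)) ℚ.+ ΣN c (λ i → g (suc i)))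
    ≡⟨ solve 4 (λ a b x y → a :+ b :+ (x :+ y) := a :+ x :+ (b :+ y)) refl
         (f 0) (g 0) (ΣN c (λ i → f (suc i))) (ΣN c (λ i → g (suc i))) ⟩
  f 0 ℚ.+ ΣN c (λ i → f (suc i)) ℚ.+ (g 0 ℚ.+ ΣN c (λ i → g (suc i))) ∎
  where open +-*-Solver

ΣN-*ˡ : ∀ c (k : ℚ) (f : ℕ → ℚ) → ΣN c (λ i → k ℚ.* f i) ≡ k ℚ.* ΣN c f
ΣN-*ˡ zero k f = sym (ℚP.*-zeroʳ k)
ΣN-*ˡ (suc c) k f = begin
  k ℚ.* f 0 ℚ.+ ΣN c (λ i → k ℚ.* f (suc i))  ≡⟨ cong (k ℚ.* f 0 ℚ.+_) (ΣN-*ˡ c k (λ i → f (suc i))) ⟩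
  k ℚ.* f 0 ℚ.+ k ℚ.* ΣN c (λ i → f (suc i))  ≡⟨ ℚP.*-distribˡ-+ k (f 0) _ ⟨
  k ℚ.* (f 0 ℚ.+ ΣN c (λ i → f (suc i)))      ∎

ΣN-last : ∀ c (f : ℕ → ℚ) → ΣN (suc c) f ≡ ΣN c f ℚ.+ f c
ΣN-last zero f = trans (ℚP.+-identityʳ (f 0)) (sym (ℚP.+-identityˡ (f 0)))
ΣN-last (suc c) f = begin
  f 0 ℚ.+ ΣN (suc c) (λ i → f (suc i))               ≡⟨ cong (f 0 ℚ.+_) (ΣN-last c (λ i → f (suc i))) ⟩
  f 0 ℚ.+ (ΣN c (λ i → f (suc i)) ℚ.+ f (suc c))     ≡⟨ ℚP.+-assoc (f 0) _ _ ⟨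
  f 0 ℚ.+ ΣN c (λ i → f (suc i)) ℚ.+ f (suc c)       ∎

ΣN-triangle-swap : ∀ c (g : ℕ → ℕ → ℚ) →
  ΣN c (λ i → ΣN (c ℕ.∸ i) (λ t → g i t)) ≡ ΣN c (λ t → ΣN (c ℕ.∸ t) (λ i → g i t))
ΣN-triangle-swap zero g = refl
ΣN-triangle-swap (suc c) g = begin
  ΣN (suc c) (g 0) ℚ.+ ΣN c (λ i → ΣN (c ℕ.∸ i) (λ t → g (suc i) t))
    ≡⟨ cong (ΣN (suc c) (g 0) ℚ.+_) (ΣN-triangle-swap c (λ i t → g (suc i) t)) ⟩
  ΣN (suc c) (g 0) ℚ.+ ΣN c (λ t → ΣN (c ℕ.∸ t) (λ i → g (suc i) t))
    ≡⟨ cong (ΣN (suc c) (g 0) ℚ.+_) (sym last-row-empty) ⟩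
  ΣN (suc c) (g 0) ℚ.+ ΣN (suc c) (λ t → ΣN (c ℕ.∸ t) (λ i → g (suc i) t))
    ≡⟨ ΣN-distrib-+ (suc c) (g 0) (λ t → ΣN (c ℕ.∸ t) (λ i → g (suc i) t)) ⟨
  ΣN (suc c) (λ t → g 0 t ℚ.+ ΣN (c ℕ.∸ t) (λ i → g (suc i) t))
    ≡⟨ ΣN-cong (suc c) (λ t t≤c → cong (λ k → ΣN k (λ i → g i t)) (sym (ℕP.+-∸-assoc 1 (ℕP.≤-pred t≤c)))) ⟩
  ΣN (suc c) (λ t → ΣN (suc c ℕ.∸ t) (λ i → g i t)) ∎
  where
  last-row-empty : ΣN (suc c) (λ t → ΣN (c ℕ.∸ t) (λ i → g (suc i) t)) ≡ ΣN c (λ t → ΣN (c ℕ.∸ t) (λ i → g (suc i) t))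
  last-row-empty = begin
    ΣN (suc c) (λ t → ΣN (c ℕ.∸ t) (λ i → g (suc i) t))
      ≡⟨ ΣN-last c (λ t → ΣN (c ℕ.∸ t) (λ i → g (suc i) t)) ⟩
    ΣN c (λ t → ΣN (c ℕ.∸ t) (λ i → g (suc i) t)) ℚ.+ ΣN (c ℕ.∸ c) (λ i → g (suc i) c)
      ≡⟨ cong (λ k → ΣN c (λ t → ΣN (c ℕ.∸ t) (λ i → g (suc i) t)) ℚ.+ ΣN k (λ i → g (suc i) c)) (ℕP.n∸n≡0 c) ⟩
    ΣN c (λ t → ΣN (c ℕ.∸ t) (λ i → g (suc i) t)) ℚ.+ 0ℚ
      ≡⟨ ℚP.+-identityʳ _ ⟩
    ΣN c (λ t → ΣN (c ℕ.∸ t) (λ i → g (suc i) t)) ∎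

sumFrom≡ΣN : ∀ a c (f : ℤ → ℚ) → sumFrom a c f ≡ ΣN c (λ i → f (a ℤ.+ + i))
sumFrom≡ΣN a zero f = refl
sumFrom≡ΣN a (suc c) f = cong₂ ℚ._+_ (cong f (sym (ℤP.+-identityʳ a)))
  (trans (sumFrom≡ΣN (a ℤ.+ + 1) c f) (ΣN-cong c (λ i _ → cong f (ℤP.+-assoc a (+ 1) (+ i)))))

sumFrom-cong-range : ∀ a c {f g : ℤ → ℚ} → (∀ i → i < c → f (a ℤ.+ + i) ≡ g (a ℤ.+ + i)) → sumFrom a c f ≡ sumFrom a c g
sumFrom-cong-range a c {f} {g} f≗g = begin
  sumFrom a c f                  ≡⟨ sumFrom≡ΣN a c f ⟩
  ΣN c (λ i → f (a ℤ.+ + i))     ≡⟨ ΣN-cong c f≗g ⟩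
  ΣN c (λ i → g (a ℤ.+ + i))     ≡⟨ sumFrom≡ΣN a c g ⟨
  sumFrom a c g                  ∎

Σ-cong : ∀ a b {f g : ℤ → ℚ} → (∀ j → f j ≡ g j) → Σ[ a ⋯ b ] f ≡ Σ[ a ⋯ b ] g
Σ-cong a b f≗g = sumFrom-cong-range a (clamp (b ℤ.- a ℤ.+ + 1)) (λ i _ → f≗g (a ℤ.+ + i))

Σ-0ℚ : ∀ a b {f : ℤ → ℚ} → (∀ j → f j ≡ 0ℚ) → Σ[ a ⋯ b ] f ≡ 0ℚ
Σ-0ℚ a b {f} f≗0 = begin
  Σ[ a ⋯ b ] f               ≡⟨ sumFrom≡ΣN a c f ⟩
  ΣN c (λ i → f (a ℤ.+ + i))  ≡⟨ ΣN-cong c (λ i _ → f≗0 (a ℤ.+ + i)) ⟩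
  ΣN c (λ _ → 0ℚ)            ≡⟨ ΣN-0ℚ c ⟩
  0ℚ                         ∎
  where c = clamp (b ℤ.- a ℤ.+ + 1)

Σ-distrib-+ : ∀ a b (f g : ℤ → ℚ) → Σ[ a ⋯ b ] (λ j → f j ℚ.+ g j) ≡ Σ[ a ⋯ b ] f ℚ.+ Σ[ a ⋯ b ] g
Σ-distrib-+ a b f g = begin
  Σ[ a ⋯ b ] (λ j → f j ℚ.+ g j)
    ≡⟨ sumFrom≡ΣN a c _ ⟩
  ΣN c (λ i → f (a ℤ.+ + i) ℚ.+ g (a ℤ.+ + i))
    ≡⟨ ΣN-distrib-+ c _ _ ⟩
  ΣN c (λ i → f (a ℤ.+ + i)) ℚ.+ ΣN c (λ i → g (a ℤ.+ + i))
    ≡⟨ cong₂ ℚ._+_ (sumFrom≡ΣN a c f) (sumFrom≡ΣN a c g) ⟨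
  Σ[ a ⋯ b ] f ℚ.+ Σ[ a ⋯ b ] g ∎
  where c = clamp (b ℤ.- a ℤ.+ + 1)

Σ-*ˡ : ∀ a b (k : ℚ) (f : ℤ → ℚ) → Σ[ a ⋯ b ] (λ j → k ℚ.* f j) ≡ k ℚ.* Σ[ a ⋯ b ] f
Σ-*ˡ a b k f = begin
  Σ[ a ⋯ b ] (λ j → k ℚ.* f j)        ≡⟨ sumFrom≡ΣN a c _ ⟩
  ΣN c (λ i → k ℚ.* f (a ℤ.+ + i))     ≡⟨ ΣN-*ˡ c k _ ⟩
  k ℚ.* ΣN c (λ i → f (a ℤ.+ + i))     ≡⟨ cong (k ℚ.*_) (sumFrom≡ΣN a c f) ⟨
  k ℚ.* Σ[ a ⋯ b ] f                   ∎
  where c = clamp (b ℤ.- a ℤ.+ + 1)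

Σ-*ʳ : ∀ a b (k : ℚ) (f : ℤ → ℚ) → Σ[ a ⋯ b ] (λ j → f j ℚ.* k) ≡ Σ[ a ⋯ b ] f ℚ.* k
Σ-*ʳ a b k f = trans (Σ-cong a b (λ j → ℚP.*-comm (f j) k)) (trans (Σ-*ˡ a b k f) (ℚP.*-comm k _))

Σ-distrib-- : ∀ a b (f g : ℤ → ℚ) → Σ[ a ⋯ b ] (λ j → f j ℚ.- g j) ≡ Σ[ a ⋯ b ] f ℚ.- Σ[ a ⋯ b ] g
Σ-distrib-- a b f g = begin
  Σ[ a ⋯ b ] (λ j → f j ℚ.- g j)
    ≡⟨ Σ-cong a b (λ j → solve 2 (λ x y → x :- y := x :+ (:- con 1ℚ) :* y) refl (f j) (g j)) ⟩
  Σ[ a ⋯ b ] (λ j → f j ℚ.+ ℚ.- 1ℚ ℚ.* g j)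
    ≡⟨ Σ-distrib-+ a b f (λ j → ℚ.- 1ℚ ℚ.* g j) ⟩
  Σ[ a ⋯ b ] f ℚ.+ Σ[ a ⋯ b ] (λ j → ℚ.- 1ℚ ℚ.* g j)
    ≡⟨ cong (Σ[ a ⋯ b ] f ℚ.+_) (Σ-*ˡ a b (ℚ.- 1ℚ) g) ⟩
  Σ[ a ⋯ b ] f ℚ.+ ℚ.- 1ℚ ℚ.* Σ[ a ⋯ b ] g
    ≡⟨ solve 2 (λ x y → x :+ (:- con 1ℚ) :* y := x :- y) refl (Σ[ a ⋯ b ] f) (Σ[ a ⋯ b ] g) ⟩
  Σ[ a ⋯ b ] f ℚ.- Σ[ a ⋯ b ] g ∎
  where open +-*-Solver

sumFrom-split : ∀ a m n (f : ℤ → ℚ) → sumFrom a (m ℕ.+ n) f ≡ sumFrom a m f ℚ.+ sumFrom (a ℤ.+ + m) n f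
sumFrom-split a zero n f = trans (cong (λ z → sumFrom z n f) (sym (ℤP.+-identityʳ a))) (sym (ℚP.+-identityˡ _))
sumFrom-split a (suc m) n f = begin
  f a ℚ.+ sumFrom (a ℤ.+ + 1) (m ℕ.+ n) f
    ≡⟨ cong (f a ℚ.+_) (sumFrom-split (a ℤ.+ + 1) m n f) ⟩
  f a ℚ.+ (sumFrom (a ℤ.+ + 1) m f ℚ.+ sumFrom (a ℤ.+ + 1 ℤ.+ + m) n f)
    ≡⟨ ℚP.+-assoc (f a) _ _ ⟨
  f a ℚ.+ sumFrom (a ℤ.+ + 1) m f ℚ.+ sumFrom (a ℤ.+ + 1 ℤ.+ + m) n f
    ≡⟨ cong (λ z → f a ℚ.+ sumFrom (a ℤ.+ + 1) m f ℚ.+ sumFrom z n f) (ℤP.+-assoc a (+ 1) (+ m)) ⟩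
  f a ℚ.+ sumFrom (a ℤ.+ + 1) m f ℚ.+ sumFrom (a ℤ.+ + suc m) n f ∎

sumFrom-negative-prefix : ∀ (f : ℤ → ℚ) → (∀ t → f -[1+ t ] ≡ 0ℚ) →
  ∀ t c → sumFrom -[1+ t ] (suc t ℕ.+ c) f ≡ sumFrom (+ 0) c f
sumFrom-negative-prefix f f[<0]≡0 zero c =
  trans (cong (ℚ._+ sumFrom (+ 0) c f) (f[<0]≡0 0)) (ℚP.+-identityˡ _)
sumFrom-negative-prefix f f[<0]≡0 (suc t) c =
  trans (cong (ℚ._+ sumFrom -[1+ t ] (suc t ℕ.+ c) f) (f[<0]≡0 (suc t)))
        (trans (ℚP.+-identityˡ _) (sumFrom-negative-prefix f f[<0]≡0 t c))

Σ₀-cong : ∀ b {f g : ℤ → ℚ} → (∀ i d → b ≡ + (i ℕ.+ d) → f (+ i) ≡ g (+ i)) → Σ[ + 0 ⋯ b ] f ≡ Σ[ + 0 ⋯ b ] g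
Σ₀-cong b f≗g = sumFrom-cong-range (+ 0) (clamp (b ℤ.- + 0 ℤ.+ + 1)) λ i i<c →
  let (d , b+1≡1+i+d) = in-range (b ℤ.- + 0 ℤ.+ + 1) i i<c
  in f≗g i d (trans (shift b) (cong (ℤ._- + 1) b+1≡1+i+d))
  where
  in-range : ∀ z i → i < clamp z → Σ ℕ λ d → z ≡ + suc (i ℕ.+ d)
  in-range (+ m) i i<m with ℕP.m≤n⇒∃[o]m+o≡n i<m
  ... | d , 1+i+d≡m = d , cong +_ (sym 1+i+d≡m)
  shift : ∀ b → b ≡ b ℤ.- + 0 ℤ.+ + 1 ℤ.- + 1
  shift = solve-∀

-- The cut c may be negative; the terms of negative index it adds on the right then vanish.
Σ₀-split : ∀ (f : ℤ → ℚ) → (∀ t → f -[1+ t ] ≡ 0ℚ) → ∀ b c s → c ℤ.+ + s ≡ + b →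
  Σ[ + 0 ⋯ + b ] f ≡ Σ[ + 0 ⋯ c ] f ℚ.+ Σ[ c ℤ.+ + 1 ⋯ + b ] f
Σ₀-split f f[<0]≡0 b (+ c) s c+s≡b with ℤP.+-injective c+s≡b
... | refl = begin
  sumFrom (+ 0) (c ℕ.+ s ℕ.+ 0 ℕ.+ 1) f
    ≡⟨ cong (λ k → sumFrom (+ 0) k f) (count c s) ⟩
  sumFrom (+ 0) (suc c ℕ.+ s) f
    ≡⟨ sumFrom-split (+ 0) (suc c) s f ⟩
  sumFrom (+ 0) (suc c) f ℚ.+ sumFrom (+ suc c) s f
    ≡⟨ cong₂ (λ k l → sumFrom (+ 0) k f ℚ.+ sumFrom (+ l) (clamp (+ s)) f) (sym c+0+1≡1+c) (ℕP.+-comm 1 c) ⟩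
  sumFrom (+ 0) (c ℕ.+ 0 ℕ.+ 1) f ℚ.+ sumFrom (+ c ℤ.+ + 1) (clamp (+ s)) f
    ≡⟨ cong (λ z → sumFrom (+ 0) (c ℕ.+ 0 ℕ.+ 1) f ℚ.+ sumFrom (+ c ℤ.+ + 1) (clamp z) f) (sym (length (+ c) (+ s))) ⟩
  Σ[ + 0 ⋯ + c ] f ℚ.+ Σ[ + c ℤ.+ + 1 ⋯ + (c ℕ.+ s) ] f ∎
  where
  count : ∀ c s → c ℕ.+ s ℕ.+ 0 ℕ.+ 1 ≡ suc c ℕ.+ s
  count = ℕ-Ring.solve-∀
  c+0+1≡1+c : c ℕ.+ 0 ℕ.+ 1 ≡ suc c
  c+0+1≡1+c = trans (cong (ℕ._+ 1) (ℕP.+-identityʳ c)) (ℕP.+-comm c 1)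
  length : ∀ c s → (c ℤ.+ s) ℤ.- (c ℤ.+ + 1) ℤ.+ + 1 ≡ s
  length = solve-∀
Σ₀-split f f[<0]≡0 b -[1+ zero ] s _ = sym (ℚP.+-identityˡ _)
Σ₀-split f f[<0]≡0 b -[1+ suc t ] s _ = begin
  sumFrom (+ 0) (b ℕ.+ 0 ℕ.+ 1) f
    ≡⟨ sumFrom-negative-prefix f f[<0]≡0 t (b ℕ.+ 0 ℕ.+ 1) ⟨
  sumFrom -[1+ t ] (suc t ℕ.+ (b ℕ.+ 0 ℕ.+ 1)) f
    ≡⟨ cong (λ k → sumFrom -[1+ t ] k f) (count t b) ⟩
  sumFrom -[1+ t ] (b ℕ.+ suc t ℕ.+ 1) f
    ≡⟨ ℚP.+-identityˡ _ ⟨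
  0ℚ ℚ.+ sumFrom -[1+ t ] (b ℕ.+ suc t ℕ.+ 1) f ∎
  where
  count : ∀ t b → suc t ℕ.+ (b ℕ.+ 0 ℕ.+ 1) ≡ b ℕ.+ suc t ℕ.+ 1
  count = ℕ-Ring.solve-∀

nCk*k!*[n∸k]!≡n! : ∀ {n k} → k ≤ n → (n C k) ℕ.* (k ! ℕ.* (n ℕ.∸ k) !) ≡ n !
nCk*k!*[n∸k]!≡n! {n} {k} k≤n =
  trans (cong (ℕ._* (k ! ℕ.* (n ℕ.∸ k) !)) (nCk≡n!/k![n-k]! k≤n)) (ℕD.m/n*n≡m (k![n∸k]!∣n! k≤n))
  where instance _ = k ℕP.!* (n ℕ.∸ k) !≢0

-- Both sides are the multinomial coefficient n! / (i! t! (n-i-t)!).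
nCi*[n∸i]Ct≡nCt*[n∸t]Ci : ∀ n i t → i ℕ.+ t ≤ n → (n C i) ℕ.* ((n ℕ.∸ i) C t) ≡ (n C t) ℕ.* ((n ℕ.∸ t) C i)
nCi*[n∸i]Ct≡nCt*[n∸t]Ci n i t i+t≤n = ℕP.*-cancelʳ-≡ _ _ (i ! ℕ.* t ! ℕ.* (n ℕ.∸ (i ℕ.+ t)) !) (begin
  (n C i) ℕ.* ((n ℕ.∸ i) C t) ℕ.* (i ! ℕ.* t ! ℕ.* (n ℕ.∸ (i ℕ.+ t)) !)
    ≡⟨ times-a!b![n∸a∸b]! i t i+t≤n ⟩
  n !
    ≡⟨ times-a!b![n∸a∸b]! t i (subst (_≤ n) (ℕP.+-comm i t) i+t≤n) ⟨
  (n C t) ℕ.* ((n ℕ.∸ t) C i) ℕ.* (t ! ℕ.* i ! ℕ.* (n ℕ.∸ (t ℕ.+ i)) !)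
    ≡⟨ cong₂ (λ x y → (n C t) ℕ.* ((n ℕ.∸ t) C i) ℕ.* (x ℕ.* (n ℕ.∸ y) !)) (ℕP.*-comm (t !) (i !)) (ℕP.+-comm t i) ⟩
  (n C t) ℕ.* ((n ℕ.∸ t) C i) ℕ.* (i ! ℕ.* t ! ℕ.* (n ℕ.∸ (i ℕ.+ t)) !) ∎)
  where
  instance
    _ = ℕP.m*n≢0 (i ! ℕ.* t !) ((n ℕ.∸ (i ℕ.+ t)) !)
          {{ℕP.m*n≢0 (i !) (t !) {{i ℕP.!≢0}} {{t ℕP.!≢0}}}} {{(n ℕ.∸ (i ℕ.+ t)) ℕP.!≢0}}
  times-a!b![n∸a∸b]! : ∀ a b → a ℕ.+ b ≤ n →
    (n C a) ℕ.* ((n ℕ.∸ a) C b) ℕ.* (a ! ℕ.* b ! ℕ.* (n ℕ.∸ (a ℕ.+ b)) !) ≡ n !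
  times-a!b![n∸a∸b]! a b a+b≤n = begin
    (n C a) ℕ.* ((n ℕ.∸ a) C b) ℕ.* (a ! ℕ.* b ! ℕ.* (n ℕ.∸ (a ℕ.+ b)) !)
      ≡⟨ cong (λ z → (n C a) ℕ.* ((n ℕ.∸ a) C b) ℕ.* (a ! ℕ.* b ! ℕ.* z !)) (sym (ℕP.∸-+-assoc n a b)) ⟩
    (n C a) ℕ.* ((n ℕ.∸ a) C b) ℕ.* (a ! ℕ.* b ! ℕ.* ((n ℕ.∸ a) ℕ.∸ b) !)
      ≡⟨ regroup (n C a) ((n ℕ.∸ a) C b) (a !) (b !) (((n ℕ.∸ a) ℕ.∸ b) !) ⟩
    (n C a) ℕ.* (a ! ℕ.* (((n ℕ.∸ a) C b) ℕ.* (b ! ℕ.* ((n ℕ.∸ a) ℕ.∸ b) !)))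
      ≡⟨ cong (λ z → (n C a) ℕ.* (a ! ℕ.* z)) (nCk*k!*[n∸k]!≡n! b≤n∸a) ⟩
    (n C a) ℕ.* (a ! ℕ.* (n ℕ.∸ a) !)
      ≡⟨ nCk*k!*[n∸k]!≡n! (ℕP.m+n≤o⇒m≤o a a+b≤n) ⟩
    n ! ∎
    where
    regroup : ∀ x y u v w → x ℕ.* y ℕ.* (u ℕ.* v ℕ.* w) ≡ x ℕ.* (u ℕ.* (y ℕ.* (v ℕ.* w)))
    regroup = ℕ-Ring.solve-∀
    b≤n∸a : b ≤ n ℕ.∸ a
    b≤n∸a = subst (_≤ n ℕ.∸ a) (ℕP.m+n∸m≡n a b) (ℕP.∸-monoˡ-≤ a a+b≤n)

[1+p]Ct*[1+p∸t]≡[1+p]*pCt : ∀ p t → t ≤ p → (suc p C t) ℕ.* (suc p ℕ.∸ t) ≡ suc p ℕ.* (p C t)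
[1+p]Ct*[1+p∸t]≡[1+p]*pCt p t t≤p = ℕP.*-cancelʳ-≡ _ _ (t ! ℕ.* (p ℕ.∸ t) !) (begin
  (suc p C t) ℕ.* (suc p ℕ.∸ t) ℕ.* (t ! ℕ.* (p ℕ.∸ t) !)
    ≡⟨ regroup (suc p C t) (suc p ℕ.∸ t) (t !) ((p ℕ.∸ t) !) ⟩
  (suc p C t) ℕ.* (t ! ℕ.* ((suc p ℕ.∸ t) ℕ.* (p ℕ.∸ t) !))
    ≡⟨ cong (λ z → (suc p C t) ℕ.* (t ! ℕ.* (z ℕ.* (p ℕ.∸ t) !))) [1+p]∸t≡1+[p∸t] ⟩
  (suc p C t) ℕ.* (t ! ℕ.* (suc (p ℕ.∸ t)) !)
    ≡⟨ cong (λ z → (suc p C t) ℕ.* (t ! ℕ.* z !)) (sym [1+p]∸t≡1+[p∸t]) ⟩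
  (suc p C t) ℕ.* (t ! ℕ.* (suc p ℕ.∸ t) !)
    ≡⟨ nCk*k!*[n∸k]!≡n! (ℕP.m≤n⇒m≤1+n t≤p) ⟩
  suc p ℕ.* p !
    ≡⟨ cong (suc p ℕ.*_) (nCk*k!*[n∸k]!≡n! t≤p) ⟨
  suc p ℕ.* ((p C t) ℕ.* (t ! ℕ.* (p ℕ.∸ t) !))
    ≡⟨ ℕP.*-assoc (suc p) (p C t) _ ⟨
  suc p ℕ.* (p C t) ℕ.* (t ! ℕ.* (p ℕ.∸ t) !) ∎)
  where
  instance _ = ℕP.m*n≢0 (t !) ((p ℕ.∸ t) !) {{t ℕP.!≢0}} {{(p ℕ.∸ t) ℕP.!≢0}}
  regroup : ∀ a b x y → a ℕ.* b ℕ.* (x ℕ.* y) ≡ a ℕ.* (x ℕ.* (b ℕ.* y))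
  regroup = ℕ-Ring.solve-∀
  [1+p]∸t≡1+[p∸t] : suc p ℕ.∸ t ≡ suc (p ℕ.∸ t)
  [1+p]∸t≡1+[p∸t] = ℕP.+-∸-assoc 1 t≤p

bernList≡map : ∀ n → bernList n ≡ map bernoulliℕ (upTo n)
bernList≡map zero = refl
bernList≡map (suc n) = begin
  bernList n ++ [ bernoulliℕ n ]                   ≡⟨ cong (_++ [ bernoulliℕ n ]) (bernList≡map n) ⟩
  map bernoulliℕ (upTo n) ++ map bernoulliℕ [ n ]  ≡⟨ ListP.map-++ bernoulliℕ (upTo n) [ n ] ⟨
  map bernoulliℕ (upTo n ++ [ n ])                 ≡⟨ cong (map bernoulliℕ) (ListP.applyUpTo-∷ʳ (λ x → x) n) ⟩
  map bernoulliℕ (upTo (suc n))                    ∎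

sumℚ-zipWith-map : ∀ (F : ℕ → ℚ → ℚ) (h : ℕ → ℚ) n (g : ℕ → ℕ) →
  sumℚ (zipWith F (applyUpTo g n) (map h (applyUpTo g n))) ≡ ΣN n (λ i → F (g i) (h (g i)))
sumℚ-zipWith-map F h zero g = refl
sumℚ-zipWith-map F h (suc n) g = cong (F (g 0) (h (g 0)) ℚ.+_) (sumℚ-zipWith-map F h n (λ i → g (suc i)))

bernoulli-recurrence : ∀ m → ΣN m (λ i → ℕtoℚ (m C i) ℚ.* bernoulliℕ i) ≡ ℕtoℚ m
bernoulli-recurrence zero = refl
bernoulli-recurrence (suc j) = begin
  ΣN (suc j) f
    ≡⟨ ΣN-last j f ⟩
  S ℚ.+ ℕtoℚ (suc j C j) ℚ.* bernoulliℕ j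
    ≡⟨ cong (λ k → S ℚ.+ ℕtoℚ k ℚ.* bernoulliℕ j) [1+j]Cj≡1+j ⟩
  S ℚ.+ ℕtoℚ (suc j) ℚ.* ((ℕtoℚ (suc j) ℚ.- S′) ℚ.* invℕ (suc j))
    ≡⟨ cong (λ z → S ℚ.+ ℕtoℚ (suc j) ℚ.* ((ℕtoℚ (suc j) ℚ.- z) ℚ.* invℕ (suc j))) S′≡S ⟩
  S ℚ.+ ℕtoℚ (suc j) ℚ.* ((ℕtoℚ (suc j) ℚ.- S) ℚ.* invℕ (suc j))
    ≡⟨ solve 3 (λ F a y → F :+ a :* ((a :- F) :* y) := F :+ (a :- F) :* (y :* a)) refl S (ℕtoℚ (suc j)) (invℕ (suc j)) ⟩
  S ℚ.+ (ℕtoℚ (suc j) ℚ.- S) ℚ.* (invℕ (suc j) ℚ.* ℕtoℚ (suc j))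
    ≡⟨ cong (λ z → S ℚ.+ (ℕtoℚ (suc j) ℚ.- S) ℚ.* z) (invℕ-inverseˡ j) ⟩
  S ℚ.+ (ℕtoℚ (suc j) ℚ.- S) ℚ.* 1ℚ
    ≡⟨ solve 2 (λ F a → F :+ (a :- F) :* con 1ℚ := a) refl S (ℕtoℚ (suc j)) ⟩
  ℕtoℚ (suc j) ∎
  where
  open +-*-Solver
  f : ℕ → ℚ
  f i = ℕtoℚ (suc j C i) ℚ.* bernoulliℕ i
  S = ΣN j f
  S′ = sumℚ (zipWith (λ i b → ℕtoℚ (suc j C i) ℚ.* b) (upTo j) (bernList j))
  S′≡S : S′ ≡ S
  S′≡S = trans (cong (λ l → sumℚ (zipWith (λ i b → ℕtoℚ (suc j C i) ℚ.* b) (upTo j) l)) (bernList≡map j))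
               (sumℚ-zipWith-map (λ i b → ℕtoℚ (suc j C i) ℚ.* b) bernoulliℕ j (λ x → x))
  [1+j]Cj≡1+j : suc j C j ≡ suc j
  [1+j]Cj≡1+j = trans (nCk≡nC[n∸k] (ℕP.n≤1+n j)) (trans (cong (suc j C_) (ℕP.m+n∸n≡m 1 j)) (nC1≡n (suc j)))

binomial-theorem : ∀ (x : ℚ) e → powℚ (1ℚ ℚ.+ x) e ≡ ΣN (suc e) (λ t → ℕtoℚ (e C t) ℚ.* powℚ x t)
binomial-theorem x zero = refl
binomial-theorem x (suc e) = begin
  (1ℚ ℚ.+ x) ℚ.* powℚ (1ℚ ℚ.+ x) e
    ≡⟨ cong ((1ℚ ℚ.+ x) ℚ.*_) (binomial-theorem x e) ⟩
  (1ℚ ℚ.+ x) ℚ.* ΣN (suc e) g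
    ≡⟨ solve 2 (λ x S → (con 1ℚ :+ x) :* S := S :+ x :* S) refl x (ΣN (suc e) g) ⟩
  ΣN (suc e) g ℚ.+ x ℚ.* ΣN (suc e) g
    ≡⟨ cong₂ ℚ._+_ shift-index (sym (ΣN-*ˡ (suc e) x g)) ⟩
  1ℚ ℚ.+ ΣN (suc e) (λ t → g (suc t)) ℚ.+ ΣN (suc e) (λ t → x ℚ.* g t)
    ≡⟨ solve 3 (λ o a b → o :+ a :+ b := o :+ (b :+ a)) refl 1ℚ (ΣN (suc e) (λ t → g (suc t))) (ΣN (suc e) (λ t → x ℚ.* g t)) ⟩
  1ℚ ℚ.+ (ΣN (suc e) (λ t → x ℚ.* g t) ℚ.+ ΣN (suc e) (λ t → g (suc t)))
    ≡⟨ cong (1ℚ ℚ.+_) (ΣN-distrib-+ (suc e) (λ t → x ℚ.* g t) (λ t → g (suc t))) ⟨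
  1ℚ ℚ.+ ΣN (suc e) (λ t → x ℚ.* g t ℚ.+ g (suc t))
    ≡⟨ cong (1ℚ ℚ.+_) (ΣN-cong (suc e) (λ t _ → pascal t)) ⟩
  1ℚ ℚ.+ ΣN (suc e) (λ t → ℕtoℚ (suc e C suc t) ℚ.* powℚ x (suc t)) ∎
  where
  open +-*-Solver
  g : ℕ → ℚ
  g t = ℕtoℚ (e C t) ℚ.* powℚ x t
  shift-index : ΣN (suc e) g ≡ 1ℚ ℚ.+ ΣN (suc e) (λ t → g (suc t))
  shift-index = begin
    g 0 ℚ.+ ΣN e (λ t → g (suc t))
      ≡⟨ cong (ℚ._+ ΣN e (λ t → g (suc t))) (ℚP.*-identityʳ 1ℚ) ⟩
    1ℚ ℚ.+ ΣN e (λ t → g (suc t))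
      ≡⟨ cong (1ℚ ℚ.+_) (ℚP.+-identityʳ (ΣN e (λ t → g (suc t)))) ⟨
    1ℚ ℚ.+ (ΣN e (λ t → g (suc t)) ℚ.+ 0ℚ)
      ≡⟨ cong (λ z → 1ℚ ℚ.+ (ΣN e (λ t → g (suc t)) ℚ.+ z)) (sym (ℚP.*-zeroˡ (powℚ x (suc e)))) ⟩
    1ℚ ℚ.+ (ΣN e (λ t → g (suc t)) ℚ.+ ℕtoℚ 0 ℚ.* powℚ x (suc e))
      ≡⟨ cong (λ k → 1ℚ ℚ.+ (ΣN e (λ t → g (suc t)) ℚ.+ ℕtoℚ k ℚ.* powℚ x (suc e))) (sym (k>n⇒nCk≡0 (ℕP.n<1+n e))) ⟩
    1ℚ ℚ.+ (ΣN e (λ t → g (suc t)) ℚ.+ g (suc e))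
      ≡⟨ cong (1ℚ ℚ.+_) (ΣN-last e (λ t → g (suc t))) ⟨
    1ℚ ℚ.+ ΣN (suc e) (λ t → g (suc t)) ∎
  pascal : ∀ t → x ℚ.* g t ℚ.+ g (suc t) ≡ ℕtoℚ (suc e C suc t) ℚ.* powℚ x (suc t)
  pascal t = begin
    x ℚ.* (ℕtoℚ (e C t) ℚ.* powℚ x t) ℚ.+ ℕtoℚ (e C suc t) ℚ.* (x ℚ.* powℚ x t)
      ≡⟨ solve 4 (λ x a b p → x :* (a :* p) :+ b :* (x :* p) := (a :+ b) :* (x :* p)) refl
           x (ℕtoℚ (e C t)) (ℕtoℚ (e C suc t)) (powℚ x t) ⟩
    (ℕtoℚ (e C t) ℚ.+ ℕtoℚ (e C suc t)) ℚ.* powℚ x (suc t)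
      ≡⟨ cong (ℚ._* powℚ x (suc t)) (ℕtoℚ-homo-+ (e C t) (e C suc t)) ⟨
    ℕtoℚ (e C t ℕ.+ e C suc t) ℚ.* powℚ x (suc t)
      ≡⟨ cong (λ k → ℕtoℚ k ℚ.* powℚ x (suc t)) (nCk+nC[k+1]≡[n+1]C[k+1] e t) ⟩
    ℕtoℚ (suc e C suc t) ℚ.* powℚ x (suc t) ∎

[1+x]^e-x^e : ∀ (x : ℚ) e → powℚ (1ℚ ℚ.+ x) e ℚ.- powℚ x e ≡ ΣN e (λ t → ℕtoℚ (e C t) ℚ.* powℚ x t)
[1+x]^e-x^e x e = begin
  powℚ (1ℚ ℚ.+ x) e ℚ.- powℚ x e
    ≡⟨ cong (ℚ._- powℚ x e) (trans (binomial-theorem x e) (ΣN-last e g)) ⟩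
  ΣN e g ℚ.+ ℕtoℚ (e C e) ℚ.* powℚ x e ℚ.- powℚ x e
    ≡⟨ cong (λ k → ΣN e g ℚ.+ ℕtoℚ k ℚ.* powℚ x e ℚ.- powℚ x e) (nCn≡1 e) ⟩
  ΣN e g ℚ.+ 1ℚ ℚ.* powℚ x e ℚ.- powℚ x e
    ≡⟨ solve 2 (λ S p → S :+ con 1ℚ :* p :- p := S) refl (ΣN e g) (powℚ x e) ⟩
  ΣN e g ∎
  where
  open +-*-Solver
  g : ℕ → ℚ
  g t = ℕtoℚ (e C t) ℚ.* powℚ x t

-- Expand each difference binomially, swap the triangular double sum, and the inner sum
-- collapses by the Bernoulli recurrence.
bernoulli-difference : ∀ (x : ℚ) p →
  ΣN (suc p) (λ i → ℕtoℚ (suc p C i) ℚ.* bernoulliℕ i ℚ.* (powℚ (1ℚ ℚ.+ x) (suc p ℕ.∸ i) ℚ.- powℚ x (suc p ℕ.∸ i)))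
    ≡ ℕtoℚ (suc p) ℚ.* powℚ (1ℚ ℚ.+ x) p
bernoulli-difference x p = begin
  ΣN n (λ i → a i ℚ.* (powℚ (1ℚ ℚ.+ x) (n ℕ.∸ i) ℚ.- powℚ x (n ℕ.∸ i)))
    ≡⟨ ΣN-cong n (λ i _ → trans (cong (a i ℚ.*_) ([1+x]^e-x^e x (n ℕ.∸ i))) (sym (ΣN-*ˡ (n ℕ.∸ i) (a i) _))) ⟩
  ΣN n (λ i → ΣN (n ℕ.∸ i) (λ t → g i t))
    ≡⟨ ΣN-triangle-swap n g ⟩
  ΣN n (λ t → ΣN (n ℕ.∸ t) (λ i → g i t))
    ≡⟨ ΣN-cong n inner-sum ⟩
  ΣN n (λ t → ℕtoℚ (n C t) ℚ.* powℚ x t ℚ.* ℕtoℚ (n ℕ.∸ t))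
    ≡⟨ ΣN-cong n absorb ⟩
  ΣN n (λ t → ℕtoℚ n ℚ.* (ℕtoℚ (p C t) ℚ.* powℚ x t))
    ≡⟨ ΣN-*ˡ n (ℕtoℚ n) (λ t → ℕtoℚ (p C t) ℚ.* powℚ x t) ⟩
  ℕtoℚ n ℚ.* ΣN n (λ t → ℕtoℚ (p C t) ℚ.* powℚ x t)
    ≡⟨ cong (ℕtoℚ n ℚ.*_) (binomial-theorem x p) ⟨
  ℕtoℚ n ℚ.* powℚ (1ℚ ℚ.+ x) p ∎
  where
  open +-*-Solver
  n = suc p
  a : ℕ → ℚ
  a i = ℕtoℚ (n C i) ℚ.* bernoulliℕ i
  g : ℕ → ℕ → ℚ
  g i t = a i ℚ.* (ℕtoℚ ((n ℕ.∸ i) C t) ℚ.* powℚ x t)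
  inner-sum : ∀ t → t < n → ΣN (n ℕ.∸ t) (λ i → g i t) ≡ ℕtoℚ (n C t) ℚ.* powℚ x t ℚ.* ℕtoℚ (n ℕ.∸ t)
  inner-sum t t<n = begin
    ΣN (n ℕ.∸ t) (λ i → g i t)
      ≡⟨ ΣN-cong (n ℕ.∸ t) regroup ⟩
    ΣN (n ℕ.∸ t) (λ i → ℕtoℚ (n C t) ℚ.* powℚ x t ℚ.* (ℕtoℚ ((n ℕ.∸ t) C i) ℚ.* bernoulliℕ i))
      ≡⟨ ΣN-*ˡ (n ℕ.∸ t) (ℕtoℚ (n C t) ℚ.* powℚ x t) _ ⟩
    ℕtoℚ (n C t) ℚ.* powℚ x t ℚ.* ΣN (n ℕ.∸ t) (λ i → ℕtoℚ ((n ℕ.∸ t) C i) ℚ.* bernoulliℕ i)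
      ≡⟨ cong (ℕtoℚ (n C t) ℚ.* powℚ x t ℚ.*_) (bernoulli-recurrence (n ℕ.∸ t)) ⟩
    ℕtoℚ (n C t) ℚ.* powℚ x t ℚ.* ℕtoℚ (n ℕ.∸ t) ∎
    where
    regroup : ∀ i → i < n ℕ.∸ t → g i t ≡ ℕtoℚ (n C t) ℚ.* powℚ x t ℚ.* (ℕtoℚ ((n ℕ.∸ t) C i) ℚ.* bernoulliℕ i)
    regroup i i<n∸t = begin
      ℕtoℚ (n C i) ℚ.* bernoulliℕ i ℚ.* (ℕtoℚ ((n ℕ.∸ i) C t) ℚ.* powℚ x t)
        ≡⟨ solve 4 (λ A b B q → A :* b :* (B :* q) := (A :* B) :* b :* q) refl
             (ℕtoℚ (n C i)) (bernoulliℕ i) (ℕtoℚ ((n ℕ.∸ i) C t)) (powℚ x t) ⟩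
      ℕtoℚ (n C i) ℚ.* ℕtoℚ ((n ℕ.∸ i) C t) ℚ.* bernoulliℕ i ℚ.* powℚ x t
        ≡⟨ cong (λ z → z ℚ.* bernoulliℕ i ℚ.* powℚ x t) swap-binomials ⟩
      ℕtoℚ (n C t) ℚ.* ℕtoℚ ((n ℕ.∸ t) C i) ℚ.* bernoulliℕ i ℚ.* powℚ x t
        ≡⟨ solve 4 (λ A B b q → A :* B :* b :* q := A :* q :* (B :* b)) refl
             (ℕtoℚ (n C t)) (ℕtoℚ ((n ℕ.∸ t) C i)) (bernoulliℕ i) (powℚ x t) ⟩
      ℕtoℚ (n C t) ℚ.* powℚ x t ℚ.* (ℕtoℚ ((n ℕ.∸ t) C i) ℚ.* bernoulliℕ i) ∎
      where
      i+t≤n : i ℕ.+ t ≤ n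
      i+t≤n = ℕP.<⇒≤ (subst (i ℕ.+ t <_) (ℕP.m∸n+n≡m (ℕP.<⇒≤ t<n)) (ℕP.+-monoˡ-< t i<n∸t))
      swap-binomials : ℕtoℚ (n C i) ℚ.* ℕtoℚ ((n ℕ.∸ i) C t) ≡ ℕtoℚ (n C t) ℚ.* ℕtoℚ ((n ℕ.∸ t) C i)
      swap-binomials = begin
        ℕtoℚ (n C i) ℚ.* ℕtoℚ ((n ℕ.∸ i) C t)    ≡⟨ ℕtoℚ-homo-* (n C i) ((n ℕ.∸ i) C t) ⟨
        ℕtoℚ ((n C i) ℕ.* ((n ℕ.∸ i) C t))       ≡⟨ cong ℕtoℚ (nCi*[n∸i]Ct≡nCt*[n∸t]Ci n i t i+t≤n) ⟩
        ℕtoℚ ((n C t) ℕ.* ((n ℕ.∸ t) C i))       ≡⟨ ℕtoℚ-homo-* (n C t) ((n ℕ.∸ t) C i) ⟩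
        ℕtoℚ (n C t) ℚ.* ℕtoℚ ((n ℕ.∸ t) C i)    ∎
  absorb : ∀ t → t < n → ℕtoℚ (n C t) ℚ.* powℚ x t ℚ.* ℕtoℚ (n ℕ.∸ t) ≡ ℕtoℚ n ℚ.* (ℕtoℚ (p C t) ℚ.* powℚ x t)
  absorb t t<n = begin
    ℕtoℚ (n C t) ℚ.* powℚ x t ℚ.* ℕtoℚ (n ℕ.∸ t)
      ≡⟨ solve 3 (λ A q D → A :* q :* D := A :* D :* q) refl (ℕtoℚ (n C t)) (powℚ x t) (ℕtoℚ (n ℕ.∸ t)) ⟩
    ℕtoℚ (n C t) ℚ.* ℕtoℚ (n ℕ.∸ t) ℚ.* powℚ x t
      ≡⟨ cong (ℚ._* powℚ x t) (ℕtoℚ-homo-* (n C t) (n ℕ.∸ t)) ⟨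
    ℕtoℚ ((n C t) ℕ.* (n ℕ.∸ t)) ℚ.* powℚ x t
      ≡⟨ cong (λ k → ℕtoℚ k ℚ.* powℚ x t) ([1+p]Ct*[1+p∸t]≡[1+p]*pCt p t (ℕP.≤-pred t<n)) ⟩
    ℕtoℚ (n ℕ.* (p C t)) ℚ.* powℚ x t
      ≡⟨ cong (ℚ._* powℚ x t) (ℕtoℚ-homo-* n (p C t)) ⟩
    ℕtoℚ n ℚ.* ℕtoℚ (p C t) ℚ.* powℚ x t
      ≡⟨ ℚP.*-assoc (ℕtoℚ n) (ℕtoℚ (p C t)) (powℚ x t) ⟩
    ℕtoℚ n ℚ.* (ℕtoℚ (p C t) ℚ.* powℚ x t) ∎

faulhaber-ℕ : ∀ p N → H N (ℤ.- + p ∷ []) ≡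
  invℕ (suc p) ℚ.* ΣN (suc p) (λ i → ℕtoℚ (suc p C i) ℚ.* bernoulliℕ i ℚ.* powℚ (ℕtoℚ N) (suc p ℕ.∸ i))
faulhaber-ℕ p zero = sym (begin
  invℕ (suc p) ℚ.* ΣN (suc p) (λ i → A i ℚ.* powℚ 0ℚ (suc p ℕ.∸ i))
    ≡⟨ cong (invℕ (suc p) ℚ.*_) (ΣN-cong (suc p) positive-power-of-0) ⟩
  invℕ (suc p) ℚ.* ΣN (suc p) (λ _ → 0ℚ)
    ≡⟨ cong (invℕ (suc p) ℚ.*_) (ΣN-0ℚ (suc p)) ⟩
  invℕ (suc p) ℚ.* 0ℚ
    ≡⟨ ℚP.*-zeroʳ (invℕ (suc p)) ⟩
  0ℚ ∎)
  where
  A : ℕ → ℚ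
  A i = ℕtoℚ (suc p C i) ℚ.* bernoulliℕ i
  positive-power-of-0 : ∀ i → i < suc p → A i ℚ.* powℚ 0ℚ (suc p ℕ.∸ i) ≡ 0ℚ
  positive-power-of-0 i i<1+p = begin
    A i ℚ.* powℚ 0ℚ (suc p ℕ.∸ i)        ≡⟨ cong (λ k → A i ℚ.* powℚ 0ℚ k) (ℕP.+-∸-assoc 1 (ℕP.≤-pred i<1+p)) ⟩
    A i ℚ.* (0ℚ ℚ.* powℚ 0ℚ (p ℕ.∸ i))   ≡⟨ cong (A i ℚ.*_) (ℚP.*-zeroˡ (powℚ 0ℚ (p ℕ.∸ i))) ⟩
    A i ℚ.* 0ℚ                           ≡⟨ ℚP.*-zeroʳ (A i) ⟩
    0ℚ                                   ∎
faulhaber-ℕ p (suc N) = begin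
  H N (ℤ.- + p ∷ []) ℚ.+ powℤ (suc N) (ℤ.- (ℤ.- + p)) ℚ.* 1ℚ
    ≡⟨ cong₂ (λ u v → u ℚ.+ powℤ (suc N) v ℚ.* 1ℚ) (faulhaber-ℕ p N) (ℤP.neg-involutive (+ p)) ⟩
  c ℚ.* S ℚ.+ powℚ y p ℚ.* 1ℚ
    ≡⟨ solve 3 (λ c S Y → c :* S :+ Y :* con 1ℚ := c :* S :+ con 1ℚ :* Y) refl c S (powℚ y p) ⟩
  c ℚ.* S ℚ.+ 1ℚ ℚ.* powℚ y p
    ≡⟨ cong (λ z → c ℚ.* S ℚ.+ z ℚ.* powℚ y p) (sym (invℕ-inverseˡ p)) ⟩
  c ℚ.* S ℚ.+ c ℚ.* ℕtoℚ (suc p) ℚ.* powℚ y p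
    ≡⟨ solve 4 (λ c S s Y → c :* S :+ c :* s :* Y := c :* (S :+ s :* Y)) refl c S (ℕtoℚ (suc p)) (powℚ y p) ⟩
  c ℚ.* (S ℚ.+ ℕtoℚ (suc p) ℚ.* powℚ y p)
    ≡⟨ cong (λ z → c ℚ.* (S ℚ.+ z)) (sym telescope-step) ⟩
  c ℚ.* (S ℚ.+ ΣN (suc p) (λ i → A i ℚ.* (powℚ y (suc p ℕ.∸ i) ℚ.- powℚ x (suc p ℕ.∸ i))))
    ≡⟨ cong (c ℚ.*_) (ΣN-distrib-+ (suc p) (λ i → A i ℚ.* powℚ x (suc p ℕ.∸ i))
         (λ i → A i ℚ.* (powℚ y (suc p ℕ.∸ i) ℚ.- powℚ x (suc p ℕ.∸ i)))) ⟨
  c ℚ.* ΣN (suc p) (λ i → A i ℚ.* powℚ x (suc p ℕ.∸ i) ℚ.+ A i ℚ.* (powℚ y (suc p ℕ.∸ i) ℚ.- powℚ x (suc p ℕ.∸ i)))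
    ≡⟨ cong (c ℚ.*_) (ΣN-cong (suc p) (λ i _ →
         solve 3 (λ a X Y → a :* X :+ a :* (Y :- X) := a :* Y) refl (A i) (powℚ x (suc p ℕ.∸ i)) (powℚ y (suc p ℕ.∸ i)))) ⟩
  c ℚ.* ΣN (suc p) (λ i → A i ℚ.* powℚ y (suc p ℕ.∸ i)) ∎
  where
  open +-*-Solver
  c = invℕ (suc p)
  x = ℕtoℚ N
  y = ℕtoℚ (suc N)
  A : ℕ → ℚ
  A i = ℕtoℚ (suc p C i) ℚ.* bernoulliℕ i
  S = ΣN (suc p) (λ i → A i ℚ.* powℚ x (suc p ℕ.∸ i))
  telescope-step : ΣN (suc p) (λ i → A i ℚ.* (powℚ y (suc p ℕ.∸ i) ℚ.- powℚ x (suc p ℕ.∸ i))) ≡ ℕtoℚ (suc p) ℚ.* powℚ y p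
  telescope-step =
    subst (λ w → ΣN (suc p) (λ i → A i ℚ.* (powℚ w (suc p ℕ.∸ i) ℚ.- powℚ x (suc p ℕ.∸ i))) ≡ ℕtoℚ (suc p) ℚ.* powℚ w p)
          (sym (ℕtoℚ-suc N)) (bernoulli-difference x p)

faulhaber : ∀ p m → H m (ℤ.- + p ∷ []) ≡
  invℕ (suc p) ℚ.* Σ[ + 0 ⋯ + p ] (λ j → binom (+ p ℤ.+ + 1) j ℚ.* B j ℚ.* powℤ m (+ p ℤ.+ + 1 ℤ.- j))
faulhaber p m = trans (faulhaber-ℕ p m) (cong (invℕ (suc p) ℚ.*_) (sym (begin
  sumFrom (+ 0) (p ℕ.+ 0 ℕ.+ 1) f
    ≡⟨ sumFrom≡ΣN (+ 0) (p ℕ.+ 0 ℕ.+ 1) f ⟩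
  ΣN (p ℕ.+ 0 ℕ.+ 1) (λ i → f (+ i))
    ≡⟨ cong (λ k → ΣN k (λ i → f (+ i))) (trans (cong (ℕ._+ 1) (ℕP.+-identityʳ p)) (ℕP.+-comm p 1)) ⟩
  ΣN (suc p) (λ i → f (+ i))
    ≡⟨ ΣN-cong (suc p) natural-exponent ⟩
  ΣN (suc p) (λ i → ℕtoℚ (suc p C i) ℚ.* bernoulliℕ i ℚ.* powℚ (ℕtoℚ m) (suc p ℕ.∸ i)) ∎)))
  where
  f : ℤ → ℚ
  f j = binom (+ p ℤ.+ + 1) j ℚ.* B j ℚ.* powℤ m (+ p ℤ.+ + 1 ℤ.- j)
  natural-exponent : ∀ i → i < suc p → f (+ i) ≡ ℕtoℚ (suc p C i) ℚ.* bernoulliℕ i ℚ.* powℚ (ℕtoℚ m) (suc p ℕ.∸ i)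
  natural-exponent i i<1+p rewrite ℕP.+-comm p 1 =
    cong (λ z → ℕtoℚ (suc p C i) ℚ.* bernoulliℕ i ℚ.* powℤ m z)
         (trans (ℤP.m-n≡m⊖n (suc p) i) (ℤP.⊖-≥ (ℕP.<⇒≤ i<1+p)))

-- Induction on n: besides (n+1)^p H_n(k,ks), the product H_{n+1}(-p) H_{n+1}(k,ks) gains
-- H_{n+1}(-p) (n+1)^(-k) H_n(ks), which by Faulhaber's formula is the increment of the sum.
by-parts-summand : ℕ → ℕ → ℤ → List ℤ → ℤ → ℚ
by-parts-summand n p k ks j = binom (+ p ℤ.+ + 1) j ℚ.* B j ℚ.* H n (k ℤ.+ j ℤ.- + p ℤ.- + 1 ∷ ks)

by-parts-summand-negative : ∀ n p k ks t → by-parts-summand n p k ks -[1+ t ] ≡ 0ℚ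
by-parts-summand-negative n p k ks t = ℚP.*-zeroˡ (H n (k ℤ.+ -[1+ t ] ℤ.- + p ℤ.- + 1 ∷ ks))

summation-by-parts : ∀ p (k : ℤ) ks n → H n (ℤ.- + p ∷ k ∷ ks) ≡
  H n (ℤ.- + p ∷ []) ℚ.* H n (k ∷ ks)
    ℚ.- invℕ (suc p) ℚ.* Σ[ + 0 ⋯ + p ] (by-parts-summand n p k ks)
summation-by-parts p k ks zero = sym (begin
  0ℚ ℚ.* 0ℚ ℚ.- c ℚ.* Σ[ + 0 ⋯ + p ] (λ j → binom (+ p ℤ.+ + 1) j ℚ.* B j ℚ.* 0ℚ)
    ≡⟨ cong (λ z → 0ℚ ℚ.* 0ℚ ℚ.- c ℚ.* z) (Σ-0ℚ (+ 0) (+ p) (λ j → ℚP.*-zeroʳ (binom (+ p ℤ.+ + 1) j ℚ.* B j))) ⟩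
  0ℚ ℚ.* 0ℚ ℚ.- c ℚ.* 0ℚ
    ≡⟨ solve 1 (λ c → con 0ℚ :* con 0ℚ :- c :* con 0ℚ := con 0ℚ) refl c ⟩
  0ℚ ∎)
  where
  open +-*-Solver
  c = invℕ (suc p)
summation-by-parts p k ks (suc n) = begin
  H n (ℤ.- + p ∷ k ∷ ks) ℚ.+ w ℚ.* Hk
    ≡⟨ cong (ℚ._+ w ℚ.* Hk) (summation-by-parts p k ks n) ⟩
  S ℚ.* Hk ℚ.- c ℚ.* G ℚ.+ w ℚ.* Hk
    ≡⟨ solve 7 (λ S Hk c G w v Hs → S :* Hk :- c :* G :+ w :* Hk
                  := (S :+ w :* con 1ℚ) :* (Hk :+ v :* Hs) :- (c :* G :+ (S :+ w :* con 1ℚ) :* v :* Hs))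
         refl S Hk c G w v Hs ⟩
  S′ ℚ.* (Hk ℚ.+ v ℚ.* Hs) ℚ.- (c ℚ.* G ℚ.+ S′ ℚ.* v ℚ.* Hs)
    ≡⟨ cong (λ z → S′ ℚ.* (Hk ℚ.+ v ℚ.* Hs) ℚ.- (c ℚ.* G ℚ.+ z ℚ.* Hs)) (sym new-terms) ⟩
  S′ ℚ.* (Hk ℚ.+ v ℚ.* Hs) ℚ.- (c ℚ.* G ℚ.+ c ℚ.* Δ ℚ.* Hs)
    ≡⟨ cong (ℚ._-_ (S′ ℚ.* (Hk ℚ.+ v ℚ.* Hs))) (solve 4 (λ c G X h → c :* G :+ c :* X :* h := c :* (G :+ X :* h)) refl c G Δ Hs) ⟩
  S′ ℚ.* (Hk ℚ.+ v ℚ.* Hs) ℚ.- c ℚ.* (G ℚ.+ Δ ℚ.* Hs)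
    ≡⟨ cong (λ z → S′ ℚ.* (Hk ℚ.+ v ℚ.* Hs) ℚ.- c ℚ.* z) (sym split-sum) ⟩
  S′ ℚ.* (Hk ℚ.+ v ℚ.* Hs) ℚ.- c ℚ.* Σ[ + 0 ⋯ + p ] (λ j → b j ℚ.* H (suc n) (e j ∷ ks)) ∎
  where
  open +-*-Solver
  c = invℕ (suc p)
  w = powℤ (suc n) (ℤ.- (ℤ.- + p))
  v = powℤ (suc n) (ℤ.- k)
  S = H n (ℤ.- + p ∷ [])
  S′ = S ℚ.+ w ℚ.* 1ℚ
  Hk = H n (k ∷ ks)
  Hs = H n ks
  b : ℤ → ℚ
  b j = binom (+ p ℤ.+ + 1) j ℚ.* B j
  e : ℤ → ℤ
  e j = k ℤ.+ j ℤ.- + p ℤ.- + 1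
  G = Σ[ + 0 ⋯ + p ] (λ j → b j ℚ.* H n (e j ∷ ks))
  Δ = Σ[ + 0 ⋯ + p ] (λ j → b j ℚ.* powℤ (suc n) (ℤ.- e j))
  split-sum : Σ[ + 0 ⋯ + p ] (λ j → b j ℚ.* H (suc n) (e j ∷ ks)) ≡ G ℚ.+ Δ ℚ.* Hs
  split-sum = begin
    Σ[ + 0 ⋯ + p ] (λ j → b j ℚ.* H (suc n) (e j ∷ ks))
      ≡⟨ Σ-cong (+ 0) (+ p) (λ j → solve 4 (λ b h q s → b :* (h :+ q :* s) := b :* h :+ b :* q :* s) refl
                                         (b j) (H n (e j ∷ ks)) (powℤ (suc n) (ℤ.- e j)) Hs) ⟩
    Σ[ + 0 ⋯ + p ] (λ j → b j ℚ.* H n (e j ∷ ks) ℚ.+ b j ℚ.* powℤ (suc n) (ℤ.- e j) ℚ.* Hs)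
      ≡⟨ Σ-distrib-+ (+ 0) (+ p) (λ j → b j ℚ.* H n (e j ∷ ks)) (λ j → b j ℚ.* powℤ (suc n) (ℤ.- e j) ℚ.* Hs) ⟩
    G ℚ.+ Σ[ + 0 ⋯ + p ] (λ j → b j ℚ.* powℤ (suc n) (ℤ.- e j) ℚ.* Hs)
      ≡⟨ cong (G ℚ.+_) (Σ-*ʳ (+ 0) (+ p) Hs (λ j → b j ℚ.* powℤ (suc n) (ℤ.- e j))) ⟩
    G ℚ.+ Δ ℚ.* Hs ∎
  exponents : ∀ P j k → P ℤ.+ + 1 ℤ.- j ℤ.+ ℤ.- k ≡ ℤ.- (k ℤ.+ j ℤ.- P ℤ.- + 1)
  exponents = solve-∀
  new-terms : c ℚ.* Δ ≡ S′ ℚ.* v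
  new-terms = sym (begin
    H (suc n) (ℤ.- + p ∷ []) ℚ.* v
      ≡⟨ cong (ℚ._* v) (faulhaber p (suc n)) ⟩
    c ℚ.* Σ[ + 0 ⋯ + p ] (λ j → b j ℚ.* powℤ (suc n) (+ p ℤ.+ + 1 ℤ.- j)) ℚ.* v
      ≡⟨ ℚP.*-assoc c _ v ⟩
    c ℚ.* (Σ[ + 0 ⋯ + p ] (λ j → b j ℚ.* powℤ (suc n) (+ p ℤ.+ + 1 ℤ.- j)) ℚ.* v)
      ≡⟨ cong (c ℚ.*_) (Σ-*ʳ (+ 0) (+ p) v (λ j → b j ℚ.* powℤ (suc n) (+ p ℤ.+ + 1 ℤ.- j))) ⟨
    c ℚ.* Σ[ + 0 ⋯ + p ] (λ j → b j ℚ.* powℤ (suc n) (+ p ℤ.+ + 1 ℤ.- j) ℚ.* v)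
      ≡⟨ cong (c ℚ.*_) (Σ-cong (+ 0) (+ p) λ j → begin
           b j ℚ.* powℤ (suc n) (+ p ℤ.+ + 1 ℤ.- j) ℚ.* v
             ≡⟨ ℚP.*-assoc (b j) _ v ⟩
           b j ℚ.* (powℤ (suc n) (+ p ℤ.+ + 1 ℤ.- j) ℚ.* v)
             ≡⟨ cong (b j ℚ.*_) (powℤ-homo-+ n (+ p ℤ.+ + 1 ℤ.- j) (ℤ.- k)) ⟩
           b j ℚ.* powℤ (suc n) (+ p ℤ.+ + 1 ℤ.- j ℤ.+ ℤ.- k)
             ≡⟨ cong (λ z → b j ℚ.* powℤ (suc n) z) (exponents (+ p) j k) ⟩
           b j ℚ.* powℤ (suc n) (ℤ.- e j) ∎) ⟩
    c ℚ.* Δ ∎)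

[x+y]-x≡y : ∀ x y → x ℤ.+ y ℤ.- x ≡ y
[x+y]-x≡y = solve-∀

x+1-[1+y]+y≡x : ∀ x y → x ℤ.+ + 1 ℤ.- (+ 1 ℤ.+ y) ℤ.+ y ≡ x
x+1-[1+y]+y≡x = solve-∀

by-parts-depth-two : ∀ n d b → H n (ℤ.- + d ∷ + suc b ∷ []) ≡
  H n (ℤ.- + d ∷ []) ℚ.* H n (+ suc b ∷ [])
    ℚ.- invℕ (suc d) ℚ.* (Σ[ + 0 ⋯ + d ℤ.+ + 1 ℤ.- + suc b ] (by-parts-summand n d (+ suc b) [])
                          ℚ.+ Σ[ + d ℤ.+ + 1 ℤ.- + suc b ℤ.+ + 1 ⋯ + d ] (by-parts-summand n d (+ suc b) []))
by-parts-depth-two n d b = trans (summation-by-parts d (+ suc b) [] n)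
  (cong (λ z → H n (ℤ.- + d ∷ []) ℚ.* H n (+ suc b ∷ []) ℚ.- invℕ (suc d) ℚ.* z)
        (Σ₀-split (by-parts-summand n d (+ suc b) []) (by-parts-summand-negative n d (+ suc b) [])
                  d (+ d ℤ.+ + 1 ℤ.- + suc b) b (x+1-[1+y]+y≡x (+ d) (+ b))))

invℤ[d+1]≡invℕ[1+d] : ∀ d → invℤ (+ d ℤ.+ + 1) ≡ invℕ (suc d)
invℤ[d+1]≡invℕ[1+d] d = cong invℕ (ℕP.+-comm d 1)

invℤ-*-positive : ∀ q r {Q R} → Q ≡ + q ℤ.+ + 1 → R ≡ + r ℤ.+ + 1 → invℤ (Q ℤ.* R) ≡ invℤ Q ℚ.* invℤ R
invℤ-*-positive q r refl refl = begin
  invℤ ((+ q ℤ.+ + 1) ℤ.* (+ r ℤ.+ + 1))     ≡⟨ cong₂ (λ x y → invℤ (+ x ℤ.* + y)) (ℕP.+-comm q 1) (ℕP.+-comm r 1) ⟩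
  invℕ (suc q ℕ.* suc r)                    ≡⟨ invℕ-homo-* q r ⟩
  invℕ (suc q) ℚ.* invℕ (suc r)             ≡⟨ cong₂ ℚ._*_ (invℤ[d+1]≡invℕ[1+d] q) (invℤ[d+1]≡invℕ[1+d] r) ⟨
  invℤ (+ q ℤ.+ + 1) ℚ.* invℤ (+ r ℤ.+ + 1) ∎

faulhaber-block : ∀ n r {Q R} → Q ≡ + r ℤ.+ + 1 → R ≡ + r →
  invℤ Q ℚ.* Σ[ + 0 ⋯ R ] (λ l → binom Q l ℚ.* B l ℚ.* powℤ n (Q ℤ.- l)) ≡ H n (ℤ.- + r ∷ [])
faulhaber-block n r refl refl =
  trans (cong (ℚ._* Σ[ + 0 ⋯ + r ] (λ l → binom (+ r ℤ.+ + 1) l ℚ.* B l ℚ.* powℤ n (+ r ℤ.+ + 1 ℤ.- l))) (invℤ[d+1]≡invℕ[1+d] r))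
        (sym (faulhaber r n))

Σ-cong-bounds : ∀ {a a′ b b′} {f g : ℤ → ℚ} → a ≡ a′ → b ≡ b′ → (∀ j → f j ≡ g j) →
  Σ[ a ⋯ b ] f ≡ Σ[ a′ ⋯ b′ ] g
Σ-cong-bounds {a} {b = b} refl refl f≗g = Σ-cong a b f≗g

module Expansion (a b p n : ℕ) where
  open +-*-Solver

  k₁ k₂ : ℕ
  k₁ = suc a
  k₂ = suc b

  E : ℤ
  E = + p ℤ.+ + 1 ℤ.- + k₁

  c Hk₂ : ℚ
  c = invℕ (suc p)
  Hk₂ = H n (+ k₂ ∷ [])

  shifted doubleH triplePow doublePowH : ℤ → ℚ
  shifted = by-parts-summand n p (+ k₁) (+ k₂ ∷ [])
  doubleH j₁ =
    Σ[ + p ℤ.+ + 3 ℤ.- + k₁ ℤ.- + k₂ ℤ.- j₁ ⋯ + p ℤ.+ + 1 ℤ.- + k₁ ℤ.- j₁ ] (λ j₂ →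
      binom (+ p ℤ.+ + 1) j₁ ℚ.* binom (+ p ℤ.+ + 2 ℤ.- + k₁ ℤ.- j₁) j₂
        ℚ.* invℤ (+ p ℤ.+ + 2 ℤ.- + k₁ ℤ.- j₁)
        ℚ.* B j₁ ℚ.* B j₂
        ℚ.* H n (+ k₁ ℤ.+ + k₂ ℤ.+ j₁ ℤ.+ j₂ ℤ.- + p ℤ.- + 2 ∷ []))
  triplePow j₁ =
    Σ[ + 0 ⋯ + p ℤ.+ + 2 ℤ.- + k₁ ℤ.- + k₂ ℤ.- j₁ ] (λ j₂ →
      Σ[ + 0 ⋯ + p ℤ.+ + 2 ℤ.- + k₁ ℤ.- + k₂ ℤ.- j₁ ℤ.- j₂ ] (λ j₃ →
        binom (+ p ℤ.+ + 1) j₁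
          ℚ.* binom (+ p ℤ.+ + 2 ℤ.- + k₁ ℤ.- j₁) j₂
          ℚ.* binom (+ p ℤ.+ + 3 ℤ.- + k₁ ℤ.- + k₂ ℤ.- j₁ ℤ.- j₂) j₃
          ℚ.* invℤ ((+ p ℤ.+ + 2 ℤ.- + k₁ ℤ.- j₁) ℤ.* (+ p ℤ.+ + 3 ℤ.- + k₁ ℤ.- + k₂ ℤ.- j₁ ℤ.- j₂))
          ℚ.* B j₁ ℚ.* B j₂ ℚ.* B j₃
          ℚ.* powℤ n (+ p ℤ.+ + 3 ℤ.- + k₁ ℤ.- + k₂ ℤ.- j₁ ℤ.- j₂ ℤ.- j₃)))
  doublePowH j =
    Σ[ + 0 ⋯ + p ℤ.+ + 1 ℤ.- + k₁ ℤ.- j ] (λ l →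
      binom (+ p ℤ.+ + 1) j ℚ.* binom (+ p ℤ.+ + 2 ℤ.- + k₁ ℤ.- j) l
        ℚ.* invℤ (+ p ℤ.+ + 2 ℤ.- + k₁ ℤ.- j)
        ℚ.* powℤ n (+ p ℤ.+ + 2 ℤ.- + k₁ ℤ.- j ℤ.- l)
        ℚ.* B j ℚ.* B l ℚ.* Hk₂)

  module _ (i d : ℕ) (E≡i+d : E ≡ + (i ℕ.+ d)) where
    private
      j Q R M E₂ : ℤ
      j = + i
      Q = + p ℤ.+ + 2 ℤ.- + k₁ ℤ.- j
      R = + p ℤ.+ + 3 ℤ.- + k₁ ℤ.- + k₂ ℤ.- j
      M = + p ℤ.+ + 2 ℤ.- + k₁ ℤ.- + k₂ ℤ.- j
      E₂ = + d ℤ.+ + 1 ℤ.- + k₂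

      β cd Lo Up : ℚ
      β = binom (+ p ℤ.+ + 1) j ℚ.* B j
      cd = invℤ (+ d ℤ.+ + 1)
      Lo = Σ[ + 0 ⋯ E₂ ] (by-parts-summand n d (+ k₂) [])
      Up = Σ[ E₂ ℤ.+ + 1 ⋯ + d ] (by-parts-summand n d (+ k₂) [])

      E-j≡d : E ℤ.- j ≡ + d
      E-j≡d = trans (cong (ℤ._- j) E≡i+d) ([x+y]-x≡y (+ i) (+ d))

      in-terms-of-d : ∀ {x} (f : ℤ → ℤ) → x ≡ f (E ℤ.- j) → x ≡ f (+ d)
      in-terms-of-d f x≡f[E-j] = trans x≡f[E-j] (cong f E-j≡d)

      Q≡d+1 : Q ≡ + d ℤ.+ + 1
      Q≡d+1 = in-terms-of-d (ℤ._+ + 1) (ring (+ p) (+ k₁) j)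
        where
        ring : ∀ P K J → P ℤ.+ + 2 ℤ.- K ℤ.- J ≡ (P ℤ.+ + 1 ℤ.- K ℤ.- J) ℤ.+ + 1
        ring = solve-∀

      k₁+j-p-1≡-d : + k₁ ℤ.+ j ℤ.- + p ℤ.- + 1 ≡ ℤ.- + d
      k₁+j-p-1≡-d = in-terms-of-d ℤ.-_ (ring (+ p) (+ k₁) j)
        where
        ring : ∀ P K J → K ℤ.+ J ℤ.- P ℤ.- + 1 ≡ ℤ.- (P ℤ.+ + 1 ℤ.- K ℤ.- J)
        ring = solve-∀

      p+3-k₁-k₂-j≡E₂+1 : + p ℤ.+ + 3 ℤ.- + k₁ ℤ.- + k₂ ℤ.- j ≡ E₂ ℤ.+ + 1
      p+3-k₁-k₂-j≡E₂+1 = in-terms-of-d (λ D → D ℤ.+ + 1 ℤ.- + k₂ ℤ.+ + 1) (ring (+ p) (+ k₁) (+ k₂) j)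
        where
        ring : ∀ P K L J → P ℤ.+ + 3 ℤ.- K ℤ.- L ℤ.- J ≡ (P ℤ.+ + 1 ℤ.- K ℤ.- J) ℤ.+ + 1 ℤ.- L ℤ.+ + 1
        ring = solve-∀

      p+2-k₁-k₂-j≡E₂ : M ≡ E₂
      p+2-k₁-k₂-j≡E₂ = in-terms-of-d (λ D → D ℤ.+ + 1 ℤ.- + k₂) (ring (+ p) (+ k₁) (+ k₂) j)
        where
        ring : ∀ P K L J → P ℤ.+ + 2 ℤ.- K ℤ.- L ℤ.- J ≡ (P ℤ.+ + 1 ℤ.- K ℤ.- J) ℤ.+ + 1 ℤ.- L
        ring = solve-∀

      second-index : ∀ l → + k₁ ℤ.+ + k₂ ℤ.+ j ℤ.+ l ℤ.- + p ℤ.- + 2 ≡ + k₂ ℤ.+ l ℤ.- + d ℤ.- + 1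
      second-index l = in-terms-of-d (λ D → + k₂ ℤ.+ l ℤ.- D ℤ.- + 1) (ring (+ p) (+ k₁) (+ k₂) j l)
        where
        ring : ∀ P K L J X → K ℤ.+ L ℤ.+ J ℤ.+ X ℤ.- P ℤ.- + 2 ≡ L ℤ.+ X ℤ.- (P ℤ.+ + 1 ℤ.- K ℤ.- J) ℤ.- + 1
        ring = solve-∀

    doublePowH≡ : doublePowH j ≡ β ℚ.* Hk₂ ℚ.* H n (ℤ.- + d ∷ [])
    doublePowH≡ = begin
      doublePowH j
        ≡⟨ Σ-cong (+ 0) (E ℤ.- j) (λ l →
             solve 7 (λ b₁ b₂ q x B₁ B₂ h → b₁ :* b₂ :* q :* x :* B₁ :* B₂ :* h := b₁ :* B₁ :* h :* q :* (b₂ :* B₂ :* x)) refl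
               (binom (+ p ℤ.+ + 1) j) (binom Q l) (invℤ Q) (powℤ n (Q ℤ.- l)) (B j) (B l) Hk₂) ⟩
      Σ[ + 0 ⋯ E ℤ.- j ] (λ l → β ℚ.* Hk₂ ℚ.* invℤ Q ℚ.* (binom Q l ℚ.* B l ℚ.* powℤ n (Q ℤ.- l)))
        ≡⟨ Σ-*ˡ (+ 0) (E ℤ.- j) (β ℚ.* Hk₂ ℚ.* invℤ Q) _ ⟩
      β ℚ.* Hk₂ ℚ.* invℤ Q ℚ.* Σ[ + 0 ⋯ E ℤ.- j ] (λ l → binom Q l ℚ.* B l ℚ.* powℤ n (Q ℤ.- l))
        ≡⟨ ℚP.*-assoc (β ℚ.* Hk₂) (invℤ Q) _ ⟩
      β ℚ.* Hk₂ ℚ.* (invℤ Q ℚ.* Σ[ + 0 ⋯ E ℤ.- j ] (λ l → binom Q l ℚ.* B l ℚ.* powℤ n (Q ℤ.- l)))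
        ≡⟨ cong (β ℚ.* Hk₂ ℚ.*_) (faulhaber-block n d Q≡d+1 E-j≡d) ⟩
      β ℚ.* Hk₂ ℚ.* H n (ℤ.- + d ∷ []) ∎

    doubleH≡ : doubleH j ≡ β ℚ.* cd ℚ.* Up
    doubleH≡ = begin
      doubleH j
        ≡⟨ Σ-cong-bounds p+3-k₁-k₂-j≡E₂+1 E-j≡d (λ l → begin
             binom (+ p ℤ.+ + 1) j ℚ.* binom Q l ℚ.* invℤ Q ℚ.* B j ℚ.* B l
               ℚ.* H n (+ k₁ ℤ.+ + k₂ ℤ.+ j ℤ.+ l ℤ.- + p ℤ.- + 2 ∷ [])
               ≡⟨ cong₂ (λ q x → binom (+ p ℤ.+ + 1) j ℚ.* binom q l ℚ.* invℤ q ℚ.* B j ℚ.* B l ℚ.* H n (x ∷ []))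
                        Q≡d+1 (second-index l) ⟩
             binom (+ p ℤ.+ + 1) j ℚ.* binom (+ d ℤ.+ + 1) l ℚ.* cd ℚ.* B j ℚ.* B l
               ℚ.* H n (+ k₂ ℤ.+ l ℤ.- + d ℤ.- + 1 ∷ [])
               ≡⟨ solve 6 (λ b₁ b₂ q B₁ B₂ h → b₁ :* b₂ :* q :* B₁ :* B₂ :* h := b₁ :* B₁ :* q :* (b₂ :* B₂ :* h)) refl
                    (binom (+ p ℤ.+ + 1) j) (binom (+ d ℤ.+ + 1) l) cd (B j) (B l) (H n (+ k₂ ℤ.+ l ℤ.- + d ℤ.- + 1 ∷ [])) ⟩
             β ℚ.* cd ℚ.* by-parts-summand n d (+ k₂) [] l ∎) ⟩
      Σ[ E₂ ℤ.+ + 1 ⋯ + d ] (λ l → β ℚ.* cd ℚ.* by-parts-summand n d (+ k₂) [] l)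
        ≡⟨ Σ-*ˡ (E₂ ℤ.+ + 1) (+ d) (β ℚ.* cd) (by-parts-summand n d (+ k₂) []) ⟩
      β ℚ.* cd ℚ.* Up ∎

    triplePow≡ : triplePow j ≡ β ℚ.* cd ℚ.* Lo
    triplePow≡ = begin
      triplePow j
        ≡⟨ Σ₀-cong (+ p ℤ.+ + 2 ℤ.- + k₁ ℤ.- + k₂ ℤ.- j) inner-sum ⟩
      Σ[ + 0 ⋯ + p ℤ.+ + 2 ℤ.- + k₁ ℤ.- + k₂ ℤ.- j ] (λ l → β ℚ.* cd ℚ.* by-parts-summand n d (+ k₂) [] l)
        ≡⟨ Σ-cong-bounds refl p+2-k₁-k₂-j≡E₂ (λ _ → refl) ⟩
      Σ[ + 0 ⋯ E₂ ] (λ l → β ℚ.* cd ℚ.* by-parts-summand n d (+ k₂) [] l)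
        ≡⟨ Σ-*ˡ (+ 0) E₂ (β ℚ.* cd) (by-parts-summand n d (+ k₂) []) ⟩
      β ℚ.* cd ℚ.* Lo ∎
      where
      inner-sum : ∀ i₂ r → M ≡ + (i₂ ℕ.+ r) →
        Σ[ + 0 ⋯ M ℤ.- + i₂ ] (λ j₃ →
          binom (+ p ℤ.+ + 1) j ℚ.* binom Q (+ i₂) ℚ.* binom (R ℤ.- + i₂) j₃
            ℚ.* invℤ (Q ℤ.* (R ℤ.- + i₂)) ℚ.* B j ℚ.* B (+ i₂) ℚ.* B j₃ ℚ.* powℤ n (R ℤ.- + i₂ ℤ.- j₃))
          ≡ β ℚ.* cd ℚ.* by-parts-summand n d (+ k₂) [] (+ i₂)
      inner-sum i₂ r M≡i₂+r = begin
        Σ[ + 0 ⋯ M ℤ.- l ] (λ j₃ → binom (+ p ℤ.+ + 1) j ℚ.* binom Q l ℚ.* binom R₁ j₃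
            ℚ.* invℤ (Q ℤ.* R₁) ℚ.* B j ℚ.* B l ℚ.* B j₃ ℚ.* powℤ n (R₁ ℤ.- j₃))
          ≡⟨ Σ-cong (+ 0) (M ℤ.- l) (λ j₃ → begin
               binom (+ p ℤ.+ + 1) j ℚ.* binom Q l ℚ.* binom R₁ j₃
                 ℚ.* invℤ (Q ℤ.* R₁) ℚ.* B j ℚ.* B l ℚ.* B j₃ ℚ.* powℤ n (R₁ ℤ.- j₃)
                 ≡⟨ cong (λ z → binom (+ p ℤ.+ + 1) j ℚ.* binom Q l ℚ.* binom R₁ j₃ ℚ.* z
                                  ℚ.* B j ℚ.* B l ℚ.* B j₃ ℚ.* powℤ n (R₁ ℤ.- j₃))
                         (invℤ-*-positive d r Q≡d+1 R₁≡r+1) ⟩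
               binom (+ p ℤ.+ + 1) j ℚ.* binom Q l ℚ.* binom R₁ j₃
                 ℚ.* (invℤ Q ℚ.* invℤ R₁) ℚ.* B j ℚ.* B l ℚ.* B j₃ ℚ.* powℤ n (R₁ ℤ.- j₃)
                 ≡⟨ solve 9 (λ b₁ b₂ b₃ q r B₁ B₂ B₃ x → b₁ :* b₂ :* b₃ :* (q :* r) :* B₁ :* B₂ :* B₃ :* x
                                                  := b₁ :* B₁ :* q :* b₂ :* B₂ :* r :* (b₃ :* B₃ :* x)) refl
                      (binom (+ p ℤ.+ + 1) j) (binom Q l) (binom R₁ j₃) (invℤ Q) (invℤ R₁)
                      (B j) (B l) (B j₃) (powℤ n (R₁ ℤ.- j₃)) ⟩
               κ ℚ.* (binom R₁ j₃ ℚ.* B j₃ ℚ.* powℤ n (R₁ ℤ.- j₃)) ∎) ⟩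
        Σ[ + 0 ⋯ M ℤ.- l ] (λ j₃ → κ ℚ.* (binom R₁ j₃ ℚ.* B j₃ ℚ.* powℤ n (R₁ ℤ.- j₃)))
          ≡⟨ Σ-*ˡ (+ 0) (M ℤ.- l) κ (λ j₃ → binom R₁ j₃ ℚ.* B j₃ ℚ.* powℤ n (R₁ ℤ.- j₃)) ⟩
        κ ℚ.* S
          ≡⟨ solve 6 (λ b q bQ Bl r S → b :* q :* bQ :* Bl :* r :* S := b :* q :* (bQ :* Bl :* (r :* S))) refl
               β (invℤ Q) (binom Q l) (B l) (invℤ R₁) S ⟩
        β ℚ.* invℤ Q ℚ.* (binom Q l ℚ.* B l ℚ.* (invℤ R₁ ℚ.* S))
          ≡⟨ cong (λ z → β ℚ.* invℤ Q ℚ.* (binom Q l ℚ.* B l ℚ.* z)) (faulhaber-block n r R₁≡r+1 M-l≡r) ⟩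
        β ℚ.* invℤ Q ℚ.* (binom Q l ℚ.* B l ℚ.* H n (ℤ.- + r ∷ []))
          ≡⟨ cong₂ (λ q x → β ℚ.* invℤ q ℚ.* (binom q l ℚ.* B l ℚ.* H n (x ∷ []))) Q≡d+1 -r≡k₂+l-d-1 ⟩
        β ℚ.* cd ℚ.* by-parts-summand n d (+ k₂) [] l ∎
        where
        l R₁ : ℤ
        l = + i₂
        R₁ = R ℤ.- l
        κ S : ℚ
        κ = β ℚ.* invℤ Q ℚ.* binom Q l ℚ.* B l ℚ.* invℤ R₁
        S = Σ[ + 0 ⋯ M ℤ.- l ] (λ j₃ → binom R₁ j₃ ℚ.* B j₃ ℚ.* powℤ n (R₁ ℤ.- j₃))
        M-l≡r : M ℤ.- l ≡ + r
        M-l≡r = trans (cong (ℤ._- l) M≡i₂+r) ([x+y]-x≡y l (+ r))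
        R₁≡r+1 : R₁ ≡ + r ℤ.+ + 1
        R₁≡r+1 = trans (ring (+ p) (+ k₁) (+ k₂) j l) (cong (ℤ._+ + 1) M-l≡r)
          where
          ring : ∀ P K L J X → P ℤ.+ + 3 ℤ.- K ℤ.- L ℤ.- J ℤ.- X ≡ (P ℤ.+ + 2 ℤ.- K ℤ.- L ℤ.- J ℤ.- X) ℤ.+ + 1
          ring = solve-∀
        -r≡k₂+l-d-1 : ℤ.- + r ≡ + k₂ ℤ.+ l ℤ.- + d ℤ.- + 1
        -r≡k₂+l-d-1 = sym (trans (ring (+ d) (+ k₂) l) (cong ℤ.-_ (trans (cong (ℤ._- l) (sym p+2-k₁-k₂-j≡E₂)) M-l≡r)))
          where
          ring : ∀ D K X → K ℤ.+ X ℤ.- D ℤ.- + 1 ≡ ℤ.- ((D ℤ.+ + 1 ℤ.- K) ℤ.- X)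
          ring = solve-∀

    shifted≡ : shifted j ≡ doublePowH j ℚ.- doubleH j ℚ.- triplePow j
    shifted≡ = begin
      β ℚ.* H n (+ k₁ ℤ.+ j ℤ.- + p ℤ.- + 1 ∷ + k₂ ∷ [])
        ≡⟨ cong (λ x → β ℚ.* H n (x ∷ + k₂ ∷ [])) k₁+j-p-1≡-d ⟩
      β ℚ.* H n (ℤ.- + d ∷ + k₂ ∷ [])
        ≡⟨ cong (β ℚ.*_) (by-parts-depth-two n d b) ⟩
      β ℚ.* (Hd ℚ.* Hk₂ ℚ.- invℕ (suc d) ℚ.* (Lo ℚ.+ Up))
        ≡⟨ cong (λ z → β ℚ.* (Hd ℚ.* Hk₂ ℚ.- z ℚ.* (Lo ℚ.+ Up))) (sym (invℤ[d+1]≡invℕ[1+d] d)) ⟩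
      β ℚ.* (Hd ℚ.* Hk₂ ℚ.- cd ℚ.* (Lo ℚ.+ Up))
        ≡⟨ solve 6 (λ β c F H L U → β :* (F :* H :- c :* (L :+ U)) := β :* H :* F :- β :* c :* U :- β :* c :* L) refl
             β cd Hd Hk₂ Lo Up ⟩
      β ℚ.* Hk₂ ℚ.* Hd ℚ.- β ℚ.* cd ℚ.* Up ℚ.- β ℚ.* cd ℚ.* Lo
        ≡⟨ cong₂ ℚ._-_ (cong₂ ℚ._-_ (sym doublePowH≡) (sym doubleH≡)) (sym triplePow≡) ⟩
      doublePowH j ℚ.- doubleH j ℚ.- triplePow j ∎
      where
      Hd : ℚ
      Hd = H n (ℤ.- + d ∷ [])

  expansion : H n (ℤ.- + p ∷ + k₁ ∷ + k₂ ∷ []) ≡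
    H n (ℤ.- + p ∷ []) ℚ.* H n (+ k₁ ∷ + k₂ ∷ []) ℚ.- c ℚ.* Σ[ + p ℤ.+ + 2 ℤ.- + k₁ ⋯ + p ] shifted
      ℚ.+ c ℚ.* Σ[ + 0 ⋯ E ] doubleH ℚ.+ c ℚ.* Σ[ + 0 ⋯ E ] triplePow ℚ.- c ℚ.* Σ[ + 0 ⋯ E ] doublePowH
  expansion = begin
    H n (ℤ.- + p ∷ + k₁ ∷ + k₂ ∷ [])
      ≡⟨ summation-by-parts p (+ k₁) (+ k₂ ∷ []) n ⟩
    T₁ ℚ.- c ℚ.* Σ[ + 0 ⋯ + p ] shifted
      ≡⟨ cong (λ z → T₁ ℚ.- c ℚ.* z) (Σ₀-split shifted (by-parts-summand-negative n p (+ k₁) (+ k₂ ∷ [])) p E a (x+1-[1+y]+y≡x (+ p) (+ a))) ⟩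
    T₁ ℚ.- c ℚ.* (Σ[ + 0 ⋯ E ] shifted ℚ.+ Σ[ E ℤ.+ + 1 ⋯ + p ] shifted)
      ≡⟨ cong₂ (λ x y → T₁ ℚ.- c ℚ.* (x ℚ.+ y)) first-part (cong (λ z → Σ[ z ⋯ + p ] shifted) (E+1≡p+2-k₁ (+ p) (+ k₁))) ⟩
    T₁ ℚ.- c ℚ.* (T₅ ℚ.- T₃ ℚ.- T₄ ℚ.+ T₂)
      ≡⟨ solve 6 (λ T₁ c T₂ T₃ T₄ T₅ → T₁ :- c :* (T₅ :- T₃ :- T₄ :+ T₂) := T₁ :- c :* T₂ :+ c :* T₃ :+ c :* T₄ :- c :* T₅) refl
           T₁ c T₂ T₃ T₄ T₅ ⟩
    T₁ ℚ.- c ℚ.* T₂ ℚ.+ c ℚ.* T₃ ℚ.+ c ℚ.* T₄ ℚ.- c ℚ.* T₅ ∎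
    where
    T₁ T₂ T₃ T₄ T₅ : ℚ
    T₁ = H n (ℤ.- + p ∷ []) ℚ.* H n (+ k₁ ∷ + k₂ ∷ [])
    T₂ = Σ[ + p ℤ.+ + 2 ℤ.- + k₁ ⋯ + p ] shifted
    T₃ = Σ[ + 0 ⋯ E ] doubleH
    T₄ = Σ[ + 0 ⋯ E ] triplePow
    T₅ = Σ[ + 0 ⋯ E ] doublePowH
    E+1≡p+2-k₁ : ∀ P K → P ℤ.+ + 1 ℤ.- K ℤ.+ + 1 ≡ P ℤ.+ + 2 ℤ.- K
    E+1≡p+2-k₁ = solve-∀
    first-part : Σ[ + 0 ⋯ E ] shifted ≡ T₅ ℚ.- T₃ ℚ.- T₄
    first-part = begin
      Σ[ + 0 ⋯ E ] shifted
        ≡⟨ Σ₀-cong E shifted≡ ⟩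
      Σ[ + 0 ⋯ E ] (λ j → doublePowH j ℚ.- doubleH j ℚ.- triplePow j)
        ≡⟨ Σ-distrib-- (+ 0) E (λ j → doublePowH j ℚ.- doubleH j) triplePow ⟩
      Σ[ + 0 ⋯ E ] (λ j → doublePowH j ℚ.- doubleH j) ℚ.- T₄
        ≡⟨ cong (ℚ._- T₄) (Σ-distrib-- (+ 0) E doublePowH doubleH) ⟩
      T₅ ℚ.- T₃ ℚ.- T₄ ∎

corollary2p4 : (k₁ k₂ p n : ℕ) → 1 ≤ k₁ → 1 ≤ k₂ → 1 ≤ n →
    H n (ℤ.- + p ∷ + k₁ ∷ + k₂ ∷ [])
      ≡ ((((H n (ℤ.- + p ∷ []) ℚ.* H n (+ k₁ ∷ + k₂ ∷ [])
        ℚ.- invℕ (suc p) ℚ.* Σ[ + p ℤ.+ + 2 ℤ.- + k₁ ⋯ + p ] (λ j →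
              binom (+ p ℤ.+ + 1) j ℚ.* B j ℚ.* H n (+ k₁ ℤ.+ j ℤ.- + p ℤ.- + 1 ∷ + k₂ ∷ [])))
        ℚ.+ invℕ (suc p) ℚ.* Σ[ + 0 ⋯ + p ℤ.+ + 1 ℤ.- + k₁ ] (λ j₁ →
              Σ[ + p ℤ.+ + 3 ℤ.- + k₁ ℤ.- + k₂ ℤ.- j₁ ⋯ + p ℤ.+ + 1 ℤ.- + k₁ ℤ.- j₁ ] (λ j₂ →
                binom (+ p ℤ.+ + 1) j₁ ℚ.* binom (+ p ℤ.+ + 2 ℤ.- + k₁ ℤ.- j₁) j₂
                  ℚ.* invℤ (+ p ℤ.+ + 2 ℤ.- + k₁ ℤ.- j₁)
                  ℚ.* B j₁ ℚ.* B j₂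
                  ℚ.* H n (+ k₁ ℤ.+ + k₂ ℤ.+ j₁ ℤ.+ j₂ ℤ.- + p ℤ.- + 2 ∷ []))))
        ℚ.+ invℕ (suc p) ℚ.* Σ[ + 0 ⋯ + p ℤ.+ + 1 ℤ.- + k₁ ] (λ j₁ →
              Σ[ + 0 ⋯ + p ℤ.+ + 2 ℤ.- + k₁ ℤ.- + k₂ ℤ.- j₁ ] (λ j₂ →
                Σ[ + 0 ⋯ + p ℤ.+ + 2 ℤ.- + k₁ ℤ.- + k₂ ℤ.- j₁ ℤ.- j₂ ] (λ j₃ →
                  binom (+ p ℤ.+ + 1) j₁
                    ℚ.* binom (+ p ℤ.+ + 2 ℤ.- + k₁ ℤ.- j₁) j₂
                    ℚ.* binom (+ p ℤ.+ + 3 ℤ.- + k₁ ℤ.- + k₂ ℤ.- j₁ ℤ.- j₂) j₃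
                    ℚ.* invℤ ((+ p ℤ.+ + 2 ℤ.- + k₁ ℤ.- j₁)
                              ℤ.* (+ p ℤ.+ + 3 ℤ.- + k₁ ℤ.- + k₂ ℤ.- j₁ ℤ.- j₂))
                    ℚ.* B j₁ ℚ.* B j₂ ℚ.* B j₃
                    ℚ.* powℤ n (+ p ℤ.+ + 3 ℤ.- + k₁ ℤ.- + k₂ ℤ.- j₁ ℤ.- j₂ ℤ.- j₃)))))
        ℚ.- invℕ (suc p) ℚ.* Σ[ + 0 ⋯ + p ℤ.+ + 1 ℤ.- + k₁ ] (λ j →
              Σ[ + 0 ⋯ + p ℤ.+ + 1 ℤ.- + k₁ ℤ.- j ] (λ l →
                binom (+ p ℤ.+ + 1) j ℚ.* binom (+ p ℤ.+ + 2 ℤ.- + k₁ ℤ.- j) l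
                  ℚ.* invℤ (+ p ℤ.+ + 2 ℤ.- + k₁ ℤ.- j)
                  ℚ.* powℤ n (+ p ℤ.+ + 2 ℤ.- + k₁ ℤ.- j ℤ.- l)
                  ℚ.* B j ℚ.* B l ℚ.* H n (+ k₂ ∷ []))))
corollary2p4 (suc a) (suc b) p n _ _ _ = Expansion.expansion a b p n
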